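{- Let $G\in\mathcal{G}_n^{sc}$ with Hermitian adjacency matrix $A$ and walk-matrix $W=[e,Ae,\ldots,A^{n-1}e]$, and let $k=\lfloor n/2\rfloor$. Define $\tilde W_1=(e,A^2e,\ldots,A^{2k-2}e)$ if $n$ is even and $\tilde W_1=(Ae,A^3e,\ldots,A^{2k-1}e)$ if $n$ is odd (so that $\frac{W^*\tilde W_1}{2}$ is a Gaussian integral matrix). If the Gaussian integer $\frac{\det W}{2^{\lfloor n/2\rfloor}}$ is odd, then $\mathrm{rank}_{1+i}\frac{W^*\tilde W_1}{2}=\lfloor n/2\rfloor$.
   Context: A mixed graph is obtained from a simple undirected graph by orienting a subset of edges; $\mathcal{G}_n$ is the set of mixed graphs on $[n]$. The Hermitian adjacency matrix $A=(a_{u,v})$ has $a_{u,v}=1$ for an undirected edge $uv$, $i$ for a directed edge $u\to v$, $-i$ for a directed edge $v\to u$, $0$ otherwise. $G$ is self-converse if isomorphic to the mixed graph obtained by reversing every directed edge; $\mathcal{G}_n^{sc}$ is the set of self-converse mixed graphs on $[n]$. $e$ is the all-one vector. A Gaussian integer $z$ is odd if $\mathrm{Re}(z)-\mathrm{Im}(z)$ is odd. $\mathrm{rank}_{1+i}(M)$ is the rank of a Gaussian integral matrix $M$ over the field $\mathbb{Z}[i]/(1+i)$. -}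

module Defs where

open import Data.Nat as ℕ using (ℕ; zero; suc; _≤_; _/_; _%_)
open import Data.Integer as ℤ using (ℤ; +_) renaming (_+_ to _+ℤ_; _*_ to _*ℤ_; -_ to -ℤ_; _-_ to _-ℤ_)
open import Data.Integer.Divisibility as ℤD using ()
open import Data.Fin using (Fin; zero; suc; punchIn; toℕ)
import Data.Nat.Base
open import Data.Fin.Permutation using (Permutation′; _⟨$⟩ʳ_)
open import Data.Bool using (Bool; true; false; _xor_; _∧_)
open import Data.Product using (Σ; ∃; _×_; _,_)
open import Relation.Nullary using (¬_)
open import Relation.Binary.PropositionalEquality using (_≡_; refl; cong)

record ℤ[i] : Set where
  constructor _+_i
  field
    re : ℤ
    im : ℤ
open ℤ[i] public

0ᵍ 1ᵍ iᵍ 2ᵍ : ℤ[i]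
0ᵍ = (+ 0) + (+ 0) i
1ᵍ = (+ 1) + (+ 0) i
iᵍ = (+ 0) + (+ 1) i
2ᵍ = (+ 2) + (+ 0) i

_+ᵍ_ : ℤ[i] → ℤ[i] → ℤ[i]
(a + b i) +ᵍ (c + d i) = (a +ℤ c) + (b +ℤ d) i

_*ᵍ_ : ℤ[i] → ℤ[i] → ℤ[i]
(a + b i) *ᵍ (c + d i) = ((a *ℤ c) -ℤ (b *ℤ d)) + ((a *ℤ d) +ℤ (b *ℤ c)) i

-ᵍ_ : ℤ[i] → ℤ[i]
-ᵍ (a + b i) = (-ℤ a) + (-ℤ b) i

conj : ℤ[i] → ℤ[i]
conj (a + b i) = a + (-ℤ b) i

_^ᵍ_ : ℤ[i] → ℕ → ℤ[i]
z ^ᵍ zero  = 1ᵍ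
z ^ᵍ suc n = z *ᵍ (z ^ᵍ n)

Odd : ℤ[i] → Set
Odd z = ¬ ((+ 2) ℤD.∣ (re z -ℤ im z))

Σᵍ : ∀ {n} → (Fin n → ℤ[i]) → ℤ[i]
Σᵍ {zero}  f = 0ᵍ
Σᵍ {suc n} f = f zero +ᵍ Σᵍ (λ j → f (suc j))

Mat : ℕ → ℕ → Set
Mat m n = Fin m → Fin n → ℤ[i]

Vecᵍ : ℕ → Set
Vecᵍ n = Fin n → ℤ[i]

_·_ : ∀ {m n} → Mat m n → Vecᵍ n → Vecᵍ m
(M · v) r = Σᵍ (λ c → M r c *ᵍ v c)

_⊗_ : ∀ {m n p} → Mat m n → Mat n p → Mat m p
(M ⊗ N) r c = Σᵍ (λ l → M r l *ᵍ N l c)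

_* : ∀ {m n} → Mat m n → Mat n m
(M *) r c = conj (M c r)

𝟙 : ∀ {n} → Vecᵍ n
𝟙 _ = 1ᵍ

det : ∀ {n} → Mat n n → ℤ[i]
det {zero}  M = 1ᵍ
det {suc n} M =
  Σᵍ (λ j → ((-ᵍ 1ᵍ) ^ᵍ toℕ j) *ᵍ (M zero j *ᵍ det (λ r c → M (suc r) (punchIn j c))))

-- type of the (ordered) pair (u , v):
--   none : no edge; undir : undirected edge uv;
--   out : directed edge u → v;  inn : directed edge v → u
data EdgeType : Set where
  none undir out inn : EdgeType

flipE : EdgeType → EdgeType
flipE none  = none
flipE undir = undir
flipE out   = inn
flipE inn   = out

record MixedGraph (n : ℕ) : Set where
  field
    rel      : Fin n → Fin n → EdgeType
    loopless : ∀ u → rel u u ≡ none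
    symm     : ∀ u v → rel v u ≡ flipE (rel u v)
open MixedGraph public

flipE-flipE : ∀ t → flipE (flipE t) ≡ t
flipE-flipE none  = refl
flipE-flipE undir = refl
flipE-flipE out   = refl
flipE-flipE inn   = refl

converse : ∀ {n} → MixedGraph n → MixedGraph n
converse G = record
  { rel      = λ u v → flipE (rel G u v)
  ; loopless = λ u → cong flipE (loopless G u)
  ; symm     = λ u v → cong flipE (symm G u v)
  }

_≅_ : ∀ {n} → MixedGraph n → MixedGraph n → Set
_≅_ {n} G H = Σ (Permutation′ n) λ σ → ∀ u v → rel H (σ ⟨$⟩ʳ u) (σ ⟨$⟩ʳ v) ≡ rel G u v

SelfConverse : ∀ {n} → MixedGraph n → Set
SelfConverse G = G ≅ converse G

hEntry : EdgeType → ℤ[i]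
hEntry none  = 0ᵍ
hEntry undir = 1ᵍ
hEntry out   = iᵍ
hEntry inn   = -ᵍ iᵍ

hermAdj : ∀ {n} → MixedGraph n → Mat n n
hermAdj G u v = hEntry (rel G u v)

walkVec : ∀ {n} → Mat n n → ℕ → Vecᵍ n
walkVec A zero    = 𝟙
walkVec A (suc j) = A · walkVec A j

walkMatrix : ∀ {n} → Mat n n → Mat n n
walkMatrix A r c = walkVec A (toℕ c) r

W̃₁ : ∀ {n} → Mat n n → Mat n (n / 2)
W̃₁ {n} A r c = walkVec A (2 ℕ.* toℕ c ℕ.+ n % 2) r

-- Rank over the residue field ℤ[i]/(1+i) ≅ 𝔽₂ (elements represented by Bool)

-- reduction ℤ[i] → ℤ[i]/(1+i): since i ≡ 1 mod (1+i), a+bi ↦ (a+b) mod 2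
red : ℤ[i] → Bool
red z = Data.Nat.Base._≡ᵇ_ (ℤ.∣ re z +ℤ im z ∣ % 2) 1

Σ₂ : ∀ {n} → (Fin n → Bool) → Bool
Σ₂ {zero}  f = false
Σ₂ {suc n} f = f zero xor Σ₂ (λ j → f (suc j))

LinIndep : ∀ {m r} → (Fin r → Fin m → Bool) → Set
LinIndep {m} {r} v = ∀ (c : Fin r → Bool) → (∀ i → Σ₂ (λ j → c j ∧ v j i) ≡ false) → ∀ j → c j ≡ false

HasIndepCols : ∀ {m k} → (Fin m → Fin k → Bool) → ℕ → Set
HasIndepCols {m} {k} M s = Σ (Fin s → Fin k) λ f → LinIndep (λ j i → M i (f j))

IsRank : ∀ {m k} → (Fin m → Fin k → Bool) → ℕ → Set
IsRank M r = HasIndepCols M r × (∀ s → HasIndepCols M s → s ≤ r)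

IsRank₁₊ᵢ : ∀ {m k} → Mat m k → ℕ → Set
IsRank₁₊ᵢ M r = IsRank (λ i j → red (M i j)) r

module Submission where

open import Defs
open import Data.Nat using (ℕ; _/_)
open import Data.Product using (Σ; _×_)
open import Relation.Binary.PropositionalEquality using (_≡_)

open import Algebra.Bundles using (CommutativeMonoid; CommutativeRing)
open import Algebra.Consequences.Propositional {A = ℤ[i]} using (comm∧idˡ⇒id; comm∧invˡ⇒inv; comm∧distrˡ⇒distrʳ)
open import Algebra.Definitions {A = ℤ[i]} _≡_
import Algebra.Properties.Semiring.Sum
open import Algebra.Structures {A = ℤ[i]} _≡_ using (IsCommutativeRing)
open import Data.Bool using (Bool; true; false; _xor_; _∧_; _∨_; if_then_else_)
open import Data.Bool.Properties using (xor-∧-commutativeRing; xor-same; ∧-zeroʳ; ∨-zeroʳ)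
open import Data.Empty using (⊥-elim)
open import Data.Fin using (Fin; zero; suc; toℕ; fromℕ<; inject₁; punchIn; punchOut; _≟_)
open import Data.Fin.Properties
  using (toℕ-injective; toℕ<n; toℕ-fromℕ<; toℕ-inject₁; punchInᵢ≢i; punchIn-punchOut; punchIn-injective;
         punchOut-injective; any?; pigeonhole)
open import Data.Integer as ℤ using (ℤ; +_; -[1+_]; _*_; _-_)
import Data.Integer.DivMod as ℤ
open import Data.Integer.Divisibility using (divides)
import Data.Integer.Properties as ℤ
open import Data.Integer.Tactic.RingSolver using () renaming (solve-∀ to ℤ-solve-∀)
open import Data.Maybe using (just; nothing)
open import Data.Nat as ℕ using (zero; suc; _%_; _≤?_)
open import Data.Nat.Induction using (<-rec)
import Data.Nat.DivMod as ℕ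
import Data.Nat.Properties as ℕ
open import Data.Product using (_,_; proj₁; proj₂; ∃)
open import Data.Sum using (_⊎_; inj₁; inj₂)
open import Data.Vec.Functional using (Vector; removeAt; updateAt)
open import Data.Vec.Functional.Properties
  using (map-updateAt; updateAt-updates; updateAt-minimal; updateAt-id-local; updateAt-commutes)
open import Function using (_∘_; const)
open import Level using (0ℓ)
open import Relation.Binary.Definitions using (tri<; tri≈; tri>)
open import Relation.Binary.PropositionalEquality
  using (_≢_; _≗_; refl; sym; trans; cong; cong₂; cong-app; subst; isEquivalence; module ≡-Reasoning)
open import Relation.Nullary using (does; yes; no)
open import Relation.Nullary.Decidable using (dec-true; dec-false)
open import Tactic.RingSolver using (solve-∀)
open import Tactic.RingSolver.Core.AlmostCommutativeRing using (AlmostCommutativeRing; fromCommutativeRing)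

-- Write H = W* W and t = n mod 2, k = ⌊n/2⌋. Since A is Hermitian, H r c = e* A^(r+c) e is a walk
-- count, and for A Hermitian with zero diagonal every walk count of positive length is even: for odd
-- length 2j+1 it is the form x* A x (x = A^j e), whose off-diagonal terms pair up as z + z̄, and for
-- even length 2j it is Σ_u |x_u|² ≡ Σ_u (Re x_u + Im x_u) (mod 2), governed by the walk count of
-- length j. Also e* e = n, which is even when t = 0. So halving the columns of H with index ≥ t gives
-- a Gaussian integral matrix H′ with 2^(2k) det H′ = det H = |det W|² = 4^k |d|², i.e. det H′ = |d|²,
-- which is a unit modulo 1 + i because d is odd. The columns of W* W̃₁ / 2 are k distinct columns of
-- H′, and distinct columns of a matrix whose determinant is a unit modulo 1 + i stay independent
-- over ℤ[i]/(1 + i); k columns cannot have larger rank.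

-- The ring of Gaussian integers

ℤ[i]-ext : ∀ {x y : ℤ[i]} → re x ≡ re y → im x ≡ im y → x ≡ y
ℤ[i]-ext = cong₂ _+_i

+ᵍ-assoc : Associative _+ᵍ_
+ᵍ-assoc (a + b i) (c + d i) (e + f i) = ℤ[i]-ext (ℤ.+-assoc a c e) (ℤ.+-assoc b d f)

+ᵍ-comm : Commutative _+ᵍ_
+ᵍ-comm (a + b i) (c + d i) = ℤ[i]-ext (ℤ.+-comm a c) (ℤ.+-comm b d)

+ᵍ-identityˡ : LeftIdentity 0ᵍ _+ᵍ_
+ᵍ-identityˡ (a + b i) = ℤ[i]-ext (ℤ.+-identityˡ a) (ℤ.+-identityˡ b)

-ᵍ-inverseˡ : LeftInverse 0ᵍ -ᵍ_ _+ᵍ_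
-ᵍ-inverseˡ (a + b i) = ℤ[i]-ext (ℤ.+-inverseˡ a) (ℤ.+-inverseˡ b)

*ᵍ-comm : Commutative _*ᵍ_
*ᵍ-comm (a + b i) (c + d i) = ℤ[i]-ext (re-comm a b c d) (im-comm a b c d)
  where
  re-comm : ∀ a b c d → a * c - b * d ≡ c * a - d * b
  re-comm = ℤ-solve-∀
  im-comm : ∀ a b c d → a * d ℤ.+ b * c ≡ c * b ℤ.+ d * a
  im-comm = ℤ-solve-∀

*ᵍ-assoc : Associative _*ᵍ_
*ᵍ-assoc (a + b i) (c + d i) (e + f i) = ℤ[i]-ext (re-assoc a b c d e f) (im-assoc a b c d e f)
  where
  re-assoc : ∀ a b c d e f →
    (a * c - b * d) * e - (a * d ℤ.+ b * c) * f ≡ a * (c * e - d * f) - b * (c * f ℤ.+ d * e)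
  re-assoc = ℤ-solve-∀
  im-assoc : ∀ a b c d e f →
    (a * c - b * d) * f ℤ.+ (a * d ℤ.+ b * c) * e ≡ a * (c * f ℤ.+ d * e) ℤ.+ b * (c * e - d * f)
  im-assoc = ℤ-solve-∀

*ᵍ-identityˡ : LeftIdentity 1ᵍ _*ᵍ_
*ᵍ-identityˡ (a + b i) = ℤ[i]-ext (re-identity a b) (im-identity a b)
  where
  re-identity : ∀ a b → + 1 * a - + 0 * b ≡ a
  re-identity = ℤ-solve-∀
  im-identity : ∀ a b → + 1 * b ℤ.+ + 0 * a ≡ b
  im-identity = ℤ-solve-∀

*ᵍ-distribˡ-+ᵍ : _*ᵍ_ DistributesOverˡ _+ᵍ_
*ᵍ-distribˡ-+ᵍ (a + b i) (c + d i) (e + f i) = ℤ[i]-ext (re-distrib a b c d e f) (im-distrib a b c d e f)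
  where
  re-distrib : ∀ a b c d e f → a * (c ℤ.+ e) - b * (d ℤ.+ f) ≡ (a * c - b * d) ℤ.+ (a * e - b * f)
  re-distrib = ℤ-solve-∀
  im-distrib : ∀ a b c d e f → a * (d ℤ.+ f) ℤ.+ b * (c ℤ.+ e) ≡ (a * d ℤ.+ b * c) ℤ.+ (a * f ℤ.+ b * e)
  im-distrib = ℤ-solve-∀

ℤ[i]-isCommutativeRing : IsCommutativeRing _+ᵍ_ _*ᵍ_ -ᵍ_ 0ᵍ 1ᵍ
ℤ[i]-isCommutativeRing = record
  { isRing = record
    { +-isAbelianGroup = record
      { isGroup = record
        { isMonoid = record
          { isSemigroup = record
            { isMagma = record { isEquivalence = isEquivalence ; ∙-cong = cong₂ _+ᵍ_ }
            ; assoc = +ᵍ-assoc }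
          ; identity = comm∧idˡ⇒id +ᵍ-comm +ᵍ-identityˡ }
        ; inverse = comm∧invˡ⇒inv +ᵍ-comm -ᵍ-inverseˡ
        ; ⁻¹-cong = cong -ᵍ_ }
      ; comm = +ᵍ-comm }
    ; *-cong = cong₂ _*ᵍ_
    ; *-assoc = *ᵍ-assoc
    ; *-identity = comm∧idˡ⇒id *ᵍ-comm *ᵍ-identityˡ
    ; distrib = *ᵍ-distribˡ-+ᵍ , comm∧distrˡ⇒distrʳ *ᵍ-comm *ᵍ-distribˡ-+ᵍ
    }
  ; *-comm = *ᵍ-comm
  }

ℤ[i]-commutativeRing : CommutativeRing 0ℓ 0ℓ
ℤ[i]-commutativeRing = record { isCommutativeRing = ℤ[i]-isCommutativeRing }

ℤ[i]-ring : AlmostCommutativeRing 0ℓ 0ℓ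
ℤ[i]-ring = fromCommutativeRing ℤ[i]-commutativeRing λ
  { ((+ 0) + (+ 0) i) → just refl
  ; _ → nothing }

open CommutativeRing ℤ[i]-commutativeRing
  using (semiring; +-commutativeMonoid)
  renaming (zeroˡ to *ᵍ-zeroˡ; zeroʳ to *ᵍ-zeroʳ; *-identityʳ to *ᵍ-identityʳ)

conj-+ᵍ : ∀ x y → conj (x +ᵍ y) ≡ conj x +ᵍ conj y
conj-+ᵍ (a + b i) (c + d i) = ℤ[i]-ext refl (ℤ.neg-distrib-+ b d)

conj-*ᵍ : ∀ x y → conj (x *ᵍ y) ≡ conj x *ᵍ conj y
conj-*ᵍ (a + b i) (c + d i) = ℤ[i]-ext (re-conj a b c d) (im-conj a b c d)
  where
  re-conj : ∀ a b c d → a * c - b * d ≡ a * c - (ℤ.- b) * (ℤ.- d)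
  re-conj = ℤ-solve-∀
  im-conj : ∀ a b c d → ℤ.- (a * d ℤ.+ b * c) ≡ a * (ℤ.- d) ℤ.+ (ℤ.- b) * c
  im-conj = ℤ-solve-∀

conj-involutive : ∀ x → conj (conj x) ≡ x
conj-involutive (a + b i) = ℤ[i]-ext refl (ℤ.neg-involutive b)

conj-^ᵍ : ∀ x k → conj (x ^ᵍ k) ≡ conj x ^ᵍ k
conj-^ᵍ x zero    = refl
conj-^ᵍ x (suc k) = trans (conj-*ᵍ x (x ^ᵍ k)) (cong (conj x *ᵍ_) (conj-^ᵍ x k))

-- Finite sums

module _ {c ℓ} (M : CommutativeMonoid c ℓ) where
  open CommutativeMonoid M using (Carrier; _≈_; _∙_; ε; ∙-congˡ; identityʳ; setoid)
  open import Algebra.Properties.CommutativeMonoid.Sum M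

  sum-single : ∀ {n} (f : Vector Carrier n) a → (∀ j → j ≢ a → f j ≈ ε) → sum f ≈ f a
  sum-single {suc n} f a f≈ε = begin
    sum f                       ≈⟨ sum-remove f ⟩
    f a ∙ sum (removeAt f a)    ≈⟨ ∙-congˡ (sum-cong-≋ {n} (λ j → f≈ε (punchIn a j) (punchInᵢ≢i a j))) ⟩
    f a ∙ sum {n} (λ _ → ε)     ≈⟨ ∙-congˡ (sum-replicate-zero n) ⟩
    f a ∙ ε                     ≈⟨ identityʳ (f a) ⟩
    f a                         ∎
    where open import Relation.Binary.Reasoning.Setoid setoid

  sum-pair : ∀ {n} (f : Vector Carrier n) {a b} → a ≢ b → (∀ j → j ≢ a → j ≢ b → f j ≈ ε) →
             sum f ≈ f a ∙ f b
  sum-pair {suc n} f {a} {b} a≢b f≈ε = begin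
    sum f                                      ≈⟨ sum-remove f ⟩
    f a ∙ sum (removeAt f a)                   ≈⟨ ∙-congˡ (sum-single (removeAt f a) b′ rest≈ε) ⟩
    f a ∙ f (punchIn a b′)                     ≡⟨ cong (λ j → f a ∙ f j) (punchIn-punchOut a≢b) ⟩
    f a ∙ f b                                  ∎
    where
    open import Relation.Binary.Reasoning.Setoid setoid
    b′ : Fin n
    b′ = punchOut a≢b
    rest≈ε : ∀ j → j ≢ b′ → f (punchIn a j) ≈ ε
    rest≈ε j j≢b′ = f≈ε (punchIn a j) (punchInᵢ≢i a j)
      (λ eq → j≢b′ (punchIn-injective a j b′ (trans eq (sym (punchIn-punchOut a≢b)))))

module ℤ[i]-Sum = Algebra.Properties.Semiring.Sum semiring
open ℤ[i]-Sum using (sum)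

Σᵍ≡sum : ∀ {n} (f : Fin n → ℤ[i]) → Σᵍ f ≡ sum f
Σᵍ≡sum {zero}  f = refl
Σᵍ≡sum {suc n} f = cong (f zero +ᵍ_) (Σᵍ≡sum (f ∘ suc))

Σᵍ-cong : ∀ {n} {f g : Fin n → ℤ[i]} → f ≗ g → Σᵍ f ≡ Σᵍ g
Σᵍ-cong {zero}  f≗g = refl
Σᵍ-cong {suc n} f≗g = cong₂ _+ᵍ_ (f≗g zero) (Σᵍ-cong (f≗g ∘ suc))

Σᵍ-distrib-+ᵍ : ∀ {n} (f g : Fin n → ℤ[i]) → Σᵍ (λ j → f j +ᵍ g j) ≡ Σᵍ f +ᵍ Σᵍ g
Σᵍ-distrib-+ᵍ f g = begin
  Σᵍ (λ j → f j +ᵍ g j)  ≡⟨ Σᵍ≡sum _ ⟩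
  sum (λ j → f j +ᵍ g j) ≡⟨ ℤ[i]-Sum.∑-distrib-+ f g ⟩
  sum f +ᵍ sum g         ≡⟨ cong₂ _+ᵍ_ (Σᵍ≡sum f) (Σᵍ≡sum g) ⟨
  Σᵍ f +ᵍ Σᵍ g           ∎
  where open ≡-Reasoning

*ᵍ-distribˡ-Σᵍ : ∀ {n} x (f : Fin n → ℤ[i]) → x *ᵍ Σᵍ f ≡ Σᵍ (λ j → x *ᵍ f j)
*ᵍ-distribˡ-Σᵍ x f = begin
  x *ᵍ Σᵍ f              ≡⟨ cong (x *ᵍ_) (Σᵍ≡sum f) ⟩
  x *ᵍ sum f             ≡⟨ ℤ[i]-Sum.*-distribˡ-sum x f ⟩
  sum (λ j → x *ᵍ f j)   ≡⟨ Σᵍ≡sum _ ⟨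
  Σᵍ (λ j → x *ᵍ f j)    ∎
  where open ≡-Reasoning

*ᵍ-distribʳ-Σᵍ : ∀ {n} x (f : Fin n → ℤ[i]) → Σᵍ f *ᵍ x ≡ Σᵍ (λ j → f j *ᵍ x)
*ᵍ-distribʳ-Σᵍ x f = begin
  Σᵍ f *ᵍ x              ≡⟨ cong (_*ᵍ x) (Σᵍ≡sum f) ⟩
  sum f *ᵍ x             ≡⟨ ℤ[i]-Sum.*-distribʳ-sum x f ⟩
  sum (λ j → f j *ᵍ x)   ≡⟨ Σᵍ≡sum _ ⟨
  Σᵍ (λ j → f j *ᵍ x)    ∎
  where open ≡-Reasoning

Σᵍ-comm : ∀ {m n} (f : Fin m → Fin n → ℤ[i]) →
          Σᵍ (λ i → Σᵍ (λ j → f i j)) ≡ Σᵍ (λ j → Σᵍ (λ i → f i j))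
Σᵍ-comm f = begin
  Σᵍ (λ i → Σᵍ (λ j → f i j))    ≡⟨ Σᵍ-cong (λ i → Σᵍ≡sum (f i)) ⟩
  Σᵍ (λ i → sum (λ j → f i j))   ≡⟨ Σᵍ≡sum _ ⟩
  sum (λ i → sum (λ j → f i j))  ≡⟨ ℤ[i]-Sum.∑-comm f ⟩
  sum (λ j → sum (λ i → f i j))  ≡⟨ Σᵍ≡sum _ ⟨
  Σᵍ (λ j → sum (λ i → f i j))   ≡⟨ Σᵍ-cong (λ j → Σᵍ≡sum (λ i → f i j)) ⟨
  Σᵍ (λ j → Σᵍ (λ i → f i j))    ∎
  where open ≡-Reasoning

Σᵍ-single : ∀ {n} (f : Fin n → ℤ[i]) a → (∀ j → j ≢ a → f j ≡ 0ᵍ) → Σᵍ f ≡ f a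
Σᵍ-single f a f≡0 = trans (Σᵍ≡sum f) (sum-single +-commutativeMonoid f a f≡0)

Σᵍ-pair : ∀ {n} (f : Fin n → ℤ[i]) {a b} → a ≢ b → (∀ j → j ≢ a → j ≢ b → f j ≡ 0ᵍ) →
          Σᵍ f ≡ f a +ᵍ f b
Σᵍ-pair f a≢b f≡0 = trans (Σᵍ≡sum f) (sum-pair +-commutativeMonoid f a≢b f≡0)

Σᵍ-zero : ∀ {n} (f : Fin n → ℤ[i]) → (∀ j → f j ≡ 0ᵍ) → Σᵍ f ≡ 0ᵍ
Σᵍ-zero {n} f f≡0 = trans (Σᵍ-cong f≡0) (trans (Σᵍ≡sum _) (ℤ[i]-Sum.sum-replicate-zero n))

conj-Σᵍ : ∀ {n} (f : Fin n → ℤ[i]) → conj (Σᵍ f) ≡ Σᵍ (conj ∘ f)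
conj-Σᵍ {zero}  f = refl
conj-Σᵍ {suc n} f = trans (conj-+ᵍ (f zero) (Σᵍ (f ∘ suc))) (cong (conj (f zero) +ᵍ_) (conj-Σᵍ (f ∘ suc)))

Σᵍ-linear : ∀ {n} a (f g : Fin n → ℤ[i]) → Σᵍ (λ j → (a *ᵍ f j) +ᵍ g j) ≡ (a *ᵍ Σᵍ f) +ᵍ Σᵍ g
Σᵍ-linear a f g = trans (Σᵍ-distrib-+ᵍ (λ j → a *ᵍ f j) g) (cong (_+ᵍ Σᵍ g) (sym (*ᵍ-distribˡ-Σᵍ a f)))

module Bool-Sum = Algebra.Properties.Semiring.Sum (CommutativeRing.semiring xor-∧-commutativeRing)

Σ₂≡sum : ∀ {n} (f : Fin n → Bool) → Σ₂ f ≡ Bool-Sum.sum f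
Σ₂≡sum {zero}  f = refl
Σ₂≡sum {suc n} f = cong (f zero xor_) (Σ₂≡sum (f ∘ suc))

Σ₂-pair : ∀ {n} (f : Fin n → Bool) {a b} → a ≢ b → (∀ j → j ≢ a → j ≢ b → f j ≡ false) → Σ₂ f ≡ f a xor f b
Σ₂-pair f a≢b f≡false = trans (Σ₂≡sum f) (sum-pair (CommutativeRing.+-commutativeMonoid xor-∧-commutativeRing) f a≢b f≡false)

Σ₂-cong : ∀ {n} {f g : Fin n → Bool} → f ≗ g → Σ₂ f ≡ Σ₂ g
Σ₂-cong {zero}  f≗g = refl
Σ₂-cong {suc n} f≗g = cong₂ _xor_ (f≗g zero) (Σ₂-cong (f≗g ∘ suc))

Σ₂-zero : ∀ {n} (f : Fin n → Bool) → (∀ j → f j ≡ false) → Σ₂ f ≡ false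
Σ₂-zero {zero}  f f≡false = refl
Σ₂-zero {suc n} f f≡false = cong₂ _xor_ (f≡false zero) (Σ₂-zero (f ∘ suc) (f≡false ∘ suc))

-- Determinants

infix 4 _≋_
_≋_ : ∀ {m n} → Mat m n → Mat m n → Set
M ≋ N = ∀ r c → M r c ≡ N r c

_ᵀ : ∀ {m n} → Mat m n → Mat n m
(M ᵀ) r c = M c r

-- sgn (suc j) unfolds to (-ᵍ 1ᵍ) *ᵍ sgn j; the ring identities in the expansions below rely on it.
sgn : ∀ {n} → Fin n → ℤ[i]
sgn j = (-ᵍ 1ᵍ) ^ᵍ toℕ j

minor : ∀ {n} → Mat (suc n) (suc n) → Fin (suc n) → Mat n n
minor M j r c = M (suc r) (punchIn j c)

setRow : ∀ {n} → Mat n n → Fin n → Vecᵍ n → Mat n n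
setRow M r v = updateAt M r (const v)

det-cong : ∀ {n} {M N : Mat n n} → M ≋ N → det M ≡ det N
det-cong {zero}  M≋N = refl
det-cong {suc n} M≋N = Σᵍ-cong λ j →
  cong₂ (λ x y → sgn j *ᵍ (x *ᵍ y)) (M≋N zero j) (det-cong (λ r c → M≋N (suc r) (punchIn j c)))

det-conj : ∀ {n} (M : Mat n n) → det (λ r c → conj (M r c)) ≡ conj (det M)
det-conj {zero}  M = refl
det-conj {suc n} M = begin
  Σᵍ (λ j → sgn j *ᵍ (conj (M zero j) *ᵍ det (λ r c → conj (minor M j r c))))
    ≡⟨ Σᵍ-cong (λ j → cong (λ x → sgn j *ᵍ (conj (M zero j) *ᵍ x)) (det-conj (minor M j))) ⟩
  Σᵍ (λ j → sgn j *ᵍ (conj (M zero j) *ᵍ conj (det (minor M j))))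
    ≡⟨ Σᵍ-cong (λ j → sym (conj-term j)) ⟩
  Σᵍ (λ j → conj (sgn j *ᵍ (M zero j *ᵍ det (minor M j))))
    ≡⟨ conj-Σᵍ (λ j → sgn j *ᵍ (M zero j *ᵍ det (minor M j))) ⟨
  conj (det M) ∎
  where
  open ≡-Reasoning
  conj-term : ∀ j → conj (sgn j *ᵍ (M zero j *ᵍ det (minor M j))) ≡ sgn j *ᵍ (conj (M zero j) *ᵍ conj (det (minor M j)))
  conj-term j = trans (conj-*ᵍ (sgn j) _) (cong₂ _*ᵍ_ (conj-^ᵍ (-ᵍ 1ᵍ) (toℕ j)) (conj-*ᵍ (M zero j) _))

-- Both sides expand into the same double sum over the minors D k j obtained by deleting rows 0 and
-- k + 1 and columns 0 and j + 1.
det-expandColumn₀ : ∀ {n} (M : Mat (suc n) (suc n)) →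
  det M ≡ Σᵍ (λ k → sgn k *ᵍ (M k zero *ᵍ det (minor (M ᵀ) k ᵀ)))
det-expandColumn₀ {zero}  M = refl
det-expandColumn₀ {suc n} M = cong ((sgn {suc (suc n)} zero *ᵍ (M zero zero *ᵍ det (minor M zero))) +ᵍ_) (begin
  Σᵍ (λ j → sgn (suc j) *ᵍ (M zero (suc j) *ᵍ det (minor M (suc j))))
    ≡⟨ Σᵍ-cong (λ j → cong (λ x → sgn (suc j) *ᵍ (M zero (suc j) *ᵍ x)) (det-expandColumn₀ (minor M (suc j)))) ⟩
  Σᵍ (λ j → sgn (suc j) *ᵍ (M zero (suc j) *ᵍ Σᵍ (λ k → sgn k *ᵍ (M (suc k) zero *ᵍ D k j))))
    ≡⟨ Σᵍ-cong (λ j → pull (sgn (suc j)) (M zero (suc j)) (λ k → sgn k *ᵍ (M (suc k) zero *ᵍ D k j))) ⟩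
  Σᵍ (λ j → Σᵍ (λ k → sgn (suc j) *ᵍ (M zero (suc j) *ᵍ (sgn k *ᵍ (M (suc k) zero *ᵍ D k j)))))
    ≡⟨ Σᵍ-comm (λ j k → sgn (suc j) *ᵍ (M zero (suc j) *ᵍ (sgn k *ᵍ (M (suc k) zero *ᵍ D k j)))) ⟩
  Σᵍ (λ k → Σᵍ (λ j → sgn (suc j) *ᵍ (M zero (suc j) *ᵍ (sgn k *ᵍ (M (suc k) zero *ᵍ D k j)))))
    ≡⟨ Σᵍ-cong (λ k → Σᵍ-cong (λ j → exchange (sgn j) (sgn k) (M zero (suc j)) (M (suc k) zero) (D k j))) ⟩
  Σᵍ (λ k → Σᵍ (λ j → sgn (suc k) *ᵍ (M (suc k) zero *ᵍ (sgn j *ᵍ (M zero (suc j) *ᵍ D k j)))))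
    ≡⟨ Σᵍ-cong (λ k → pull (sgn (suc k)) (M (suc k) zero) (λ j → sgn j *ᵍ (M zero (suc j) *ᵍ D k j))) ⟨
  Σᵍ (λ k → sgn (suc k) *ᵍ (M (suc k) zero *ᵍ det (minor (M ᵀ) (suc k) ᵀ))) ∎)
  where
  open ≡-Reasoning
  D : Fin (suc n) → Fin (suc n) → ℤ[i]
  D k j = det (λ r c → M (suc (punchIn k r)) (suc (punchIn j c)))
  pull : ∀ {m} s x (f : Fin m → ℤ[i]) → s *ᵍ (x *ᵍ Σᵍ f) ≡ Σᵍ (λ l → s *ᵍ (x *ᵍ f l))
  pull s x f = trans (cong (s *ᵍ_) (*ᵍ-distribˡ-Σᵍ x f)) (*ᵍ-distribˡ-Σᵍ s _)
  exchange : ∀ sj si a b d → ((-ᵍ 1ᵍ) *ᵍ sj) *ᵍ (a *ᵍ (si *ᵍ (b *ᵍ d))) ≡ ((-ᵍ 1ᵍ) *ᵍ si) *ᵍ (b *ᵍ (sj *ᵍ (a *ᵍ d)))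
  exchange = solve-∀ ℤ[i]-ring

det-ᵀ : ∀ {n} (M : Mat n n) → det (M ᵀ) ≡ det M
det-ᵀ {zero}  M = refl
det-ᵀ {suc n} M = trans (Σᵍ-cong λ j → cong (λ x → sgn j *ᵍ (M j zero *ᵍ x)) (det-ᵀ (minor (M ᵀ) j ᵀ)))
                        (sym (det-expandColumn₀ M))

minor-setRow : ∀ {n} (M : Mat (suc n) (suc n)) r w j →
  minor (setRow M (suc r) w) j ≋ setRow (minor M j) r (w ∘ punchIn j)
minor-setRow M r w j x = cong-app (map-updateAt {f = _∘ punchIn j} (λ _ → refl) (M ∘ suc) r x)

det-row-linear : ∀ {n} (M : Mat n n) r a (u v : Vecᵍ n) →
  det (setRow M r (λ c → (a *ᵍ u c) +ᵍ v c)) ≡ (a *ᵍ det (setRow M r u)) +ᵍ det (setRow M r v)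
det-row-linear {suc n} M zero a u v = begin
  Σᵍ (λ j → sgn j *ᵍ (((a *ᵍ u j) +ᵍ v j) *ᵍ det (minor M j)))
    ≡⟨ Σᵍ-cong (λ j → distribute (sgn j) a (u j) (v j) (det (minor M j))) ⟩
  Σᵍ (λ j → (a *ᵍ term u j) +ᵍ term v j)
    ≡⟨ Σᵍ-linear a (term u) (term v) ⟩
  (a *ᵍ det (setRow M zero u)) +ᵍ det (setRow M zero v) ∎
  where
  open ≡-Reasoning
  term : Vecᵍ (suc n) → Fin (suc n) → ℤ[i]
  term w j = sgn j *ᵍ (w j *ᵍ det (minor M j))
  distribute : ∀ s a x y d → s *ᵍ (((a *ᵍ x) +ᵍ y) *ᵍ d) ≡ (a *ᵍ (s *ᵍ (x *ᵍ d))) +ᵍ (s *ᵍ (y *ᵍ d))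
  distribute = solve-∀ ℤ[i]-ring
det-row-linear {suc n} M (suc r) a u v = begin
  det (setRow M (suc r) (λ c → (a *ᵍ u c) +ᵍ v c))
    ≡⟨ expand (λ c → (a *ᵍ u c) +ᵍ v c) ⟩
  Σᵍ (term (λ c → (a *ᵍ u c) +ᵍ v c))
    ≡⟨ Σᵍ-cong (λ j → cong (λ x → sgn j *ᵍ (M zero j *ᵍ x)) (det-row-linear (minor M j) r a (u ∘ punchIn j) (v ∘ punchIn j))) ⟩
  Σᵍ (λ j → sgn j *ᵍ (M zero j *ᵍ ((a *ᵍ det (setRow (minor M j) r (u ∘ punchIn j))) +ᵍ det (setRow (minor M j) r (v ∘ punchIn j)))))
    ≡⟨ Σᵍ-cong (λ j → distribute (sgn j) (M zero j) a (det (setRow (minor M j) r (u ∘ punchIn j))) (det (setRow (minor M j) r (v ∘ punchIn j)))) ⟩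
  Σᵍ (λ j → (a *ᵍ term u j) +ᵍ term v j)
    ≡⟨ Σᵍ-linear a (term u) (term v) ⟩
  (a *ᵍ Σᵍ (term u)) +ᵍ Σᵍ (term v)
    ≡⟨ cong₂ (λ x y → (a *ᵍ x) +ᵍ y) (expand u) (expand v) ⟨
  (a *ᵍ det (setRow M (suc r) u)) +ᵍ det (setRow M (suc r) v) ∎
  where
  open ≡-Reasoning
  term : Vecᵍ (suc n) → Fin (suc n) → ℤ[i]
  term w j = sgn j *ᵍ (M zero j *ᵍ det (setRow (minor M j) r (w ∘ punchIn j)))
  expand : ∀ w → det (setRow M (suc r) w) ≡ Σᵍ (term w)
  expand w = Σᵍ-cong λ j → cong (λ x → sgn j *ᵍ (M zero j *ᵍ x)) (det-cong (minor-setRow M r w j))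
  distribute : ∀ s m a x y → s *ᵍ (m *ᵍ ((a *ᵍ x) +ᵍ y)) ≡ (a *ᵍ (s *ᵍ (m *ᵍ x))) +ᵍ (s *ᵍ (m *ᵍ y))
  distribute = solve-∀ ℤ[i]-ring

punchIn-adjacent : ∀ {m} (a c : Fin m) →
  punchIn (inject₁ a) c ≡ punchIn (suc a) c ⊎ (punchIn (inject₁ a) c ≡ suc a × punchIn (suc a) c ≡ inject₁ a)
punchIn-adjacent zero    zero    = inj₂ (refl , refl)
punchIn-adjacent zero    (suc c) = inj₁ refl
punchIn-adjacent (suc a) zero    = inj₁ refl
punchIn-adjacent (suc a) (suc c) with punchIn-adjacent a c
... | inj₁ eq         = inj₁ (cong suc eq)
... | inj₂ (eq , eq′) = inj₂ (cong suc eq , cong suc eq′)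

punchIn-avoiding-adjacent : ∀ {m} (a : Fin (suc m)) j → j ≢ inject₁ a → j ≢ suc a →
  ∃ λ b → punchIn j (inject₁ b) ≡ inject₁ a × punchIn j (suc b) ≡ suc a
punchIn-avoiding-adjacent zero    zero          j≢a _    = ⊥-elim (j≢a refl)
punchIn-avoiding-adjacent zero    (suc zero)    _   j≢1+a = ⊥-elim (j≢1+a refl)
punchIn-avoiding-adjacent {suc m} zero (suc (suc j)) _ _  = zero , refl , refl
punchIn-avoiding-adjacent (suc a) zero          _   _    = a , refl , refl
punchIn-avoiding-adjacent {suc m} (suc a) (suc j) j≢a j≢1+a
  with punchIn-avoiding-adjacent a j (j≢a ∘ cong suc) (j≢1+a ∘ cong suc)
... | b , eq , eq′ = suc b , cong suc eq , cong suc eq′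

inject₁≢suc : ∀ {m} (a : Fin m) → inject₁ a ≢ suc a
inject₁≢suc a eq = ℕ.1+n≢n (trans (sym (cong toℕ eq)) (toℕ-inject₁ a))

det-adjacent-columns : ∀ {n} (M : Mat (suc n) (suc n)) a → (∀ r → M r (inject₁ a) ≡ M r (suc a)) → det M ≡ 0ᵍ
det-adjacent-columns {suc m} M a cols≡ = begin
  det M                            ≡⟨ Σᵍ-pair term (inject₁≢suc a) vanishing ⟩
  term (inject₁ a) +ᵍ term (suc a) ≡⟨ cong₂ (λ s x → (s *ᵍ (x *ᵍ det (minor M (inject₁ a)))) +ᵍ term (suc a))
                                            (cong ((-ᵍ 1ᵍ) ^ᵍ_) (toℕ-inject₁ a)) (cols≡ zero) ⟩
  (sgn a *ᵍ (M zero (suc a) *ᵍ det (minor M (inject₁ a)))) +ᵍ term (suc a)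
                                   ≡⟨ cong (λ x → (sgn a *ᵍ (M zero (suc a) *ᵍ x)) +ᵍ term (suc a)) (det-cong same-minors) ⟩
  (sgn a *ᵍ (M zero (suc a) *ᵍ det (minor M (suc a)))) +ᵍ term (suc a)
                                   ≡⟨ cancel (sgn a) (M zero (suc a)) (det (minor M (suc a))) ⟩
  0ᵍ                               ∎
  where
  open ≡-Reasoning
  term : Fin (suc (suc m)) → ℤ[i]
  term j = sgn j *ᵍ (M zero j *ᵍ det (minor M j))
  vanishing : ∀ j → j ≢ inject₁ a → j ≢ suc a → term j ≡ 0ᵍ
  vanishing j j≢a j≢1+a with punchIn-avoiding-adjacent a j j≢a j≢1+a
  ... | b , eq , eq′ = trans
    (cong (λ x → sgn j *ᵍ (M zero j *ᵍ x))
          (det-adjacent-columns (minor M j) b (λ r → trans (cong (M (suc r)) eq) (trans (cols≡ (suc r)) (cong (M (suc r)) (sym eq′))))))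
    (trans (cong (sgn j *ᵍ_) (*ᵍ-zeroʳ (M zero j))) (*ᵍ-zeroʳ (sgn j)))
  same-minors : minor M (inject₁ a) ≋ minor M (suc a)
  same-minors r c with punchIn-adjacent a c
  ... | inj₁ eq         = cong (M (suc r)) eq
  ... | inj₂ (eq , eq′) = trans (cong (M (suc r)) eq) (trans (sym (cols≡ (suc r))) (cong (M (suc r)) (sym eq′)))
  cancel : ∀ s x d → (s *ᵍ (x *ᵍ d)) +ᵍ (((-ᵍ 1ᵍ) *ᵍ s) *ᵍ (x *ᵍ d)) ≡ 0ᵍ
  cancel = solve-∀ ℤ[i]-ring

det-adjacent-rows : ∀ {n} (M : Mat (suc n) (suc n)) a → (∀ c → M (inject₁ a) c ≡ M (suc a) c) → det M ≡ 0ᵍ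
det-adjacent-rows M a rows≡ = trans (sym (det-ᵀ M)) (det-adjacent-columns (M ᵀ) a rows≡)

δ : ∀ {n} → Fin n → Fin n → ℤ[i]
δ a b = if does (a ≟ b) then 1ᵍ else 0ᵍ

δ-refl : ∀ {n} (a : Fin n) → δ a a ≡ 1ᵍ
δ-refl a = cong (if_then 1ᵍ else 0ᵍ) (dec-true (a ≟ a) refl)

δ-≢ : ∀ {n} {a b : Fin n} → a ≢ b → δ a b ≡ 0ᵍ
δ-≢ {a = a} {b} a≢b = cong (if_then 1ᵍ else 0ᵍ) (dec-false (a ≟ b) a≢b)

𝕀 : ∀ {n} → Mat n n
𝕀 = δ

det-𝕀 : ∀ {n} → det (𝕀 {n}) ≡ 1ᵍ
det-𝕀 {zero}  = refl
det-𝕀 {suc n} = begin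
  det (𝕀 {suc n})
    ≡⟨ Σᵍ-single (λ j → sgn j *ᵍ (δ zero j *ᵍ det (minor (𝕀 {suc n}) j))) zero off-diagonal ⟩
  sgn {suc n} zero *ᵍ (1ᵍ *ᵍ det (𝕀 {n}))                  ≡⟨ cong (λ x → 1ᵍ *ᵍ (1ᵍ *ᵍ x)) (det-𝕀 {n}) ⟩
  1ᵍ *ᵍ (1ᵍ *ᵍ 1ᵍ)                                          ≡⟨⟩
  1ᵍ                                                       ∎
  where
  open ≡-Reasoning
  off-diagonal : ∀ j → j ≢ zero → sgn j *ᵍ (δ zero j *ᵍ det (minor (𝕀 {suc n}) j)) ≡ 0ᵍ
  off-diagonal j j≢0 = trans (cong (λ x → sgn j *ᵍ (x *ᵍ det (minor (𝕀 {suc n}) j))) (δ-≢ (j≢0 ∘ sym)))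
                             (trans (cong (sgn j *ᵍ_) (*ᵍ-zeroˡ (det (minor (𝕀 {suc n}) j)))) (*ᵍ-zeroʳ (sgn j)))

-- Alternating multilinear forms and the product formula

swapAt : ∀ {a} {A : Set a} {n} → Vector A n → Fin n → Fin n → Vector A n
swapAt xs a b = updateAt (updateAt xs a (const (xs b))) b (const (xs a))

module _ {a} {A : Set a} {n} (xs : Vector A n) {p q : Fin n} where

  swapAt-second : swapAt xs p q q ≡ xs p
  swapAt-second = updateAt-updates q (updateAt xs p (const (xs q)))

  swapAt-first : p ≢ q → swapAt xs p q p ≡ xs q
  swapAt-first p≢q = trans (updateAt-minimal p q _ p≢q) (updateAt-updates p xs)

  swapAt-other : ∀ {k} → k ≢ p → k ≢ q → swapAt xs p q k ≡ xs k
  swapAt-other k≢p k≢q = trans (updateAt-minimal _ q _ k≢q) (updateAt-minimal _ p xs k≢p)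

map-swapAt : ∀ {a b} {A : Set a} {B : Set b} {n} (f : A → B) (xs : Vector A n) p q →
             f ∘ swapAt xs p q ≗ swapAt (f ∘ xs) p q
map-swapAt f xs p q k with k ≟ q | k ≟ p
... | yes refl | _        = trans (cong f (swapAt-second xs)) (sym (swapAt-second (f ∘ xs)))
... | no k≢q   | yes refl = trans (cong f (swapAt-first xs k≢q)) (sym (swapAt-first (f ∘ xs) k≢q))
... | no k≢q   | no k≢p   = trans (cong f (swapAt-other xs k≢p k≢q)) (sym (swapAt-other (f ∘ xs) k≢p k≢q))

setRow-cong : ∀ {n} (M : Mat n n) r {v w : Vecᵍ n} → v ≗ w → setRow M r v ≋ setRow M r w
setRow-cong M r v≗w x c with x ≟ r
... | yes refl = trans (cong-app (updateAt-updates r M) c) (trans (v≗w c) (sym (cong-app (updateAt-updates r M) c)))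
... | no x≢r   = trans (cong-app (updateAt-minimal x r M x≢r) c) (sym (cong-app (updateAt-minimal x r M x≢r) c))

setRows : ∀ {n} → Mat n n → Fin n → Fin n → Vecᵍ n → Vecᵍ n → Mat n n
setRows M a b u v = setRow (setRow M a u) b v

module _ {n} (M : Mat n n) {a b : Fin n} {u v : Vecᵍ n} where

  setRows-second : setRows M a b u v b ≡ v
  setRows-second = updateAt-updates b (setRow M a u)

  setRows-first : a ≢ b → setRows M a b u v a ≡ u
  setRows-first a≢b = trans (updateAt-minimal a b _ a≢b) (updateAt-updates a M)

  setRows-comm : a ≢ b → setRows M a b u v ≋ setRow (setRow M b v) a u
  setRows-comm a≢b x = cong-app (updateAt-commutes b a (a≢b ∘ sym) M x)

setRows-unchanged : ∀ {n} (M : Mat n n) {a b} → a ≢ b → setRows M a b (M a) (M b) ≋ M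
setRows-unchanged M {a} {b} a≢b x =
  cong-app (trans (updateAt-id-local b (setRow M a (M a)) (sym (updateAt-minimal b a M (a≢b ∘ sym))) x)
                  (updateAt-id-local a M refl x))

record IsAlternatingMultilinear {n} (D : Mat n n → ℤ[i]) : Set where
  field
    resp-≋        : ∀ {M N} → M ≋ N → D M ≡ D N
    row-linear    : ∀ M r a (u v : Vecᵍ n) →
                    D (setRow M r (λ c → (a *ᵍ u c) +ᵍ v c)) ≡ (a *ᵍ D (setRow M r u)) +ᵍ D (setRow M r v)
    adjacent-rows : ∀ M a b → toℕ b ≡ suc (toℕ a) → M a ≗ M b → D M ≡ 0ᵍ

det-isAlternatingMultilinear : ∀ {n} → IsAlternatingMultilinear (det {n})
det-isAlternatingMultilinear = record
  { resp-≋        = det-cong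
  ; row-linear    = det-row-linear
  ; adjacent-rows = adjacent
  }
  where
  adjacent : ∀ {n} (M : Mat n n) a b → toℕ b ≡ suc (toℕ a) → M a ≗ M b → det M ≡ 0ᵍ
  adjacent {suc m} M a (suc b) 1+b≡1+a rows≡ with toℕ-injective {i = a} {j = inject₁ b}
                                                  (trans (ℕ.suc-injective (sym 1+b≡1+a)) (sym (toℕ-inject₁ b)))
  ... | refl = det-adjacent-rows M b rows≡

module AlternatingMultilinear {n} {D : Mat n n → ℤ[i]} (isD : IsAlternatingMultilinear D) where
  open IsAlternatingMultilinear isD

  row-+ : ∀ M r (u v : Vecᵍ n) → D (setRow M r (λ c → u c +ᵍ v c)) ≡ D (setRow M r u) +ᵍ D (setRow M r v)
  row-+ M r u v = begin
    D (setRow M r (λ c → u c +ᵍ v c))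
      ≡⟨ resp-≋ (setRow-cong M r (λ c → cong (_+ᵍ v c) (sym (*ᵍ-identityˡ (u c))))) ⟩
    D (setRow M r (λ c → (1ᵍ *ᵍ u c) +ᵍ v c))        ≡⟨ row-linear M r 1ᵍ u v ⟩
    (1ᵍ *ᵍ D (setRow M r u)) +ᵍ D (setRow M r v)     ≡⟨ cong (_+ᵍ D (setRow M r v)) (*ᵍ-identityˡ (D (setRow M r u))) ⟩
    D (setRow M r u) +ᵍ D (setRow M r v)             ∎
    where open ≡-Reasoning

  zero-row : ∀ M r → D (setRow M r (λ _ → 0ᵍ)) ≡ 0ᵍ
  zero-row M r = begin
    D (setRow M r (λ _ → 0ᵍ))                                          ≡⟨ resp-≋ (setRow-cong M r (λ _ → refl)) ⟩
    D (setRow M r (λ _ → ((-ᵍ 1ᵍ) *ᵍ 0ᵍ) +ᵍ 0ᵍ))                          ≡⟨ row-linear M r (-ᵍ 1ᵍ) (λ _ → 0ᵍ) (λ _ → 0ᵍ) ⟩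
    ((-ᵍ 1ᵍ) *ᵍ D (setRow M r (λ _ → 0ᵍ))) +ᵍ D (setRow M r (λ _ → 0ᵍ)) ≡⟨ cancel (D (setRow M r (λ _ → 0ᵍ))) ⟩
    0ᵍ                                                                  ∎
    where
    open ≡-Reasoning
    cancel : ∀ x → ((-ᵍ 1ᵍ) *ᵍ x) +ᵍ x ≡ 0ᵍ
    cancel = solve-∀ ℤ[i]-ring

  row-Σ : ∀ {k} M r (coef : Fin k → ℤ[i]) (v : Fin k → Vecᵍ n) →
          D (setRow M r (λ c → Σᵍ (λ j → coef j *ᵍ v j c))) ≡ Σᵍ (λ j → coef j *ᵍ D (setRow M r (v j)))
  row-Σ {zero}  M r coef v = zero-row M r
  row-Σ {suc k} M r coef v =
    trans (row-linear M r (coef zero) (v zero) (λ c → Σᵍ (λ j → coef (suc j) *ᵍ v (suc j) c)))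
          (cong ((coef zero *ᵍ D (setRow M r (v zero))) +ᵍ_) (row-Σ M r (coef ∘ suc) (v ∘ suc)))

  swap-rows : ∀ M {a b} → a ≢ b → (∀ N → N a ≗ N b → D N ≡ 0ᵍ) → D (swapAt M a b) ≡ -ᵍ D M
  swap-rows M {a} {b} a≢b alternating = begin
    f (M b) (M a)                                       ≡⟨ isolate (D M) (f (M b) (M a)) ⟩
    ((0ᵍ +ᵍ D M) +ᵍ (f (M b) (M a) +ᵍ 0ᵍ)) +ᵍ (-ᵍ D M)   ≡⟨ cong (_+ᵍ (-ᵍ D M)) expansion ⟨
    0ᵍ +ᵍ (-ᵍ D M)                                      ≡⟨ +ᵍ-identityˡ (-ᵍ D M) ⟩
    -ᵍ D M                                              ∎
    where
    open ≡-Reasoning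
    f : Vecᵍ n → Vecᵍ n → ℤ[i]
    f u v = D (setRows M a b u v)
    f-diagonal : ∀ u → f u u ≡ 0ᵍ
    f-diagonal u = alternating (setRows M a b u u)
      (λ c → trans (cong-app (setRows-first M a≢b) c) (sym (cong-app (setRows-second M) c)))
    f-+ˡ : ∀ u₁ u₂ v → f (λ c → u₁ c +ᵍ u₂ c) v ≡ f u₁ v +ᵍ f u₂ v
    f-+ˡ u₁ u₂ v = begin
      f (λ c → u₁ c +ᵍ u₂ c) v                          ≡⟨ resp-≋ (setRows-comm M a≢b) ⟩
      D (setRow (setRow M b v) a (λ c → u₁ c +ᵍ u₂ c))  ≡⟨ row-+ (setRow M b v) a u₁ u₂ ⟩
      D (setRow (setRow M b v) a u₁) +ᵍ D (setRow (setRow M b v) a u₂)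
        ≡⟨ cong₂ _+ᵍ_ (resp-≋ (setRows-comm M a≢b)) (resp-≋ (setRows-comm M a≢b)) ⟨
      f u₁ v +ᵍ f u₂ v                                  ∎
    f-+ʳ : ∀ u v₁ v₂ → f u (λ c → v₁ c +ᵍ v₂ c) ≡ f u v₁ +ᵍ f u v₂
    f-+ʳ u = row-+ (setRow M a u) b
    s : Vecᵍ n
    s c = M a c +ᵍ M b c
    expansion : 0ᵍ ≡ (0ᵍ +ᵍ D M) +ᵍ (f (M b) (M a) +ᵍ 0ᵍ)
    expansion = begin
      0ᵍ                                                            ≡⟨ f-diagonal s ⟨
      f s s                                                         ≡⟨ f-+ˡ (M a) (M b) s ⟩
      f (M a) s +ᵍ f (M b) s
        ≡⟨ cong₂ _+ᵍ_ (f-+ʳ (M a) (M a) (M b)) (f-+ʳ (M b) (M a) (M b)) ⟩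
      (f (M a) (M a) +ᵍ f (M a) (M b)) +ᵍ (f (M b) (M a) +ᵍ f (M b) (M b))
        ≡⟨ cong₂ (λ x y → (x +ᵍ f (M a) (M b)) +ᵍ (f (M b) (M a) +ᵍ y)) (f-diagonal (M a)) (f-diagonal (M b)) ⟩
      (0ᵍ +ᵍ f (M a) (M b)) +ᵍ (f (M b) (M a) +ᵍ 0ᵍ)
        ≡⟨ cong (λ x → (0ᵍ +ᵍ x) +ᵍ (f (M b) (M a) +ᵍ 0ᵍ)) (resp-≋ (setRows-unchanged M a≢b)) ⟩
      (0ᵍ +ᵍ D M) +ᵍ (f (M b) (M a) +ᵍ 0ᵍ)                          ∎
    isolate : ∀ x y → y ≡ ((0ᵍ +ᵍ x) +ᵍ (y +ᵍ 0ᵍ)) +ᵍ (-ᵍ x)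
    isolate = solve-∀ ℤ[i]-ring

basisMatrix : ∀ {n} → (Fin n → Fin n) → Mat n n
basisMatrix σ x = δ (σ x)

Σᵍ-δ : ∀ {n} (f : Fin n → ℤ[i]) c → Σᵍ (λ l → f l *ᵍ δ l c) ≡ f c
Σᵍ-δ f c = trans (Σᵍ-single (λ l → f l *ᵍ δ l c) c (λ l l≢c → trans (cong (f l *ᵍ_) (δ-≢ l≢c)) (*ᵍ-zeroʳ (f l))))
                 (trans (cong (f c *ᵍ_) (δ-refl c)) (*ᵍ-identityʳ (f c)))

missed-value⇒collision : ∀ {n} (σ : Fin n → Fin n) r → (∀ x → σ x ≢ r) → ∃ λ x → ∃ λ y → x ≢ y × σ x ≡ σ y
missed-value⇒collision {suc m} σ r r∉σ with pigeonhole (ℕ.n<1+n m) (λ x → punchOut (r∉σ x ∘ sym))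
... | x , y , x<y , eq = x , y , (λ x≡y → ℕ.<-irrefl (cong toℕ x≡y) x<y) , punchOut-injective (r∉σ x ∘ sym) (r∉σ y ∘ sym) eq

gap : ∀ {m n} → m ℕ.< n → n ≡ suc ((n ℕ.∸ suc m) ℕ.+ m)
gap {m} {n} m<n = sym (trans (cong suc (ℕ.+-comm (n ℕ.∸ suc m) m)) (ℕ.m+[n∸m]≡n m<n))

module Vanishing {n} {D : Mat n n → ℤ[i]} (isD : IsAlternatingMultilinear D) where
  open IsAlternatingMultilinear isD
  open AlternatingMultilinear isD

  private
    zero-if-negation-zero : ∀ x → -ᵍ x ≡ 0ᵍ → x ≡ 0ᵍ
    zero-if-negation-zero x -x≡0 = trans (sym (-ᵍ-involutive x)) (cong -ᵍ_ -x≡0)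
      where -ᵍ-involutive : ∀ x → -ᵍ (-ᵍ x) ≡ x
            -ᵍ-involutive = solve-∀ ℤ[i]-ring

  equal-rows-at-distance : ∀ k M a b → toℕ b ≡ suc (k ℕ.+ toℕ a) → M a ≗ M b → D M ≡ 0ᵍ
  equal-rows-at-distance zero    M a b b≡1+a rows≡ = adjacent-rows M a b b≡1+a rows≡
  equal-rows-at-distance (suc k) M a b b≡2+k+a rows≡ = zero-if-negation-zero (D M) (begin
    -ᵍ D M              ≡⟨ swap-rows M b′≢b (λ N → adjacent-rows N b′ b b≡1+b′) ⟨
    D (swapAt M b′ b)   ≡⟨ equal-rows-at-distance k (swapAt M b′ b) a b′ (toℕ-fromℕ< b′<n) rows≡′ ⟩
    0ᵍ                  ∎)
    where
    open ≡-Reasoning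
    b′<n : suc (k ℕ.+ toℕ a) ℕ.< n
    b′<n = ℕ.<-trans (ℕ.n<1+n _) (subst (ℕ._< n) b≡2+k+a (toℕ<n b))
    b′ : Fin n
    b′ = fromℕ< b′<n
    b≡1+b′ : toℕ b ≡ suc (toℕ b′)
    b≡1+b′ = trans b≡2+k+a (cong suc (sym (toℕ-fromℕ< b′<n)))
    b′≢b : b′ ≢ b
    b′≢b b′≡b = ℕ.1+n≢n (trans (sym b≡1+b′) (cong toℕ (sym b′≡b)))
    a≢b′ : a ≢ b′
    a≢b′ a≡b′ = ℕ.m≢1+n+m (toℕ a) (trans (cong toℕ a≡b′) (toℕ-fromℕ< b′<n))
    a≢b : a ≢ b
    a≢b a≡b = ℕ.m≢1+n+m (toℕ a) (trans (cong toℕ a≡b) b≡2+k+a)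
    rows≡′ : swapAt M b′ b a ≗ swapAt M b′ b b′
    rows≡′ c = trans (cong-app (swapAt-other M a≢b′ a≢b) c) (trans (rows≡ c) (sym (cong-app (swapAt-first M b′≢b) c)))

  equal-rows : ∀ M {a b} → a ≢ b → M a ≗ M b → D M ≡ 0ᵍ
  equal-rows M {a} {b} a≢b rows≡ with ℕ.<-cmp (toℕ a) (toℕ b)
  ... | tri< a<b _ _ = equal-rows-at-distance _ M a b (gap a<b) rows≡
  ... | tri≈ _ a≡b _ = ⊥-elim (a≢b (toℕ-injective a≡b))
  ... | tri> _ _ b<a = equal-rows-at-distance _ M b a (gap b<a) (sym ∘ rows≡)

  FixesBelow : ℕ → (Fin n → Fin n) → Set
  FixesBelow k σ = ∀ x → toℕ x ℕ.< k → σ x ≡ x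

  fixesBelow-suc : ∀ {k} σ → FixesBelow k σ → (∀ x → toℕ x ≡ k → σ x ≡ x) → FixesBelow (suc k) σ
  fixesBelow-suc σ fixes fixes-k x x<1+k with ℕ.m<1+n⇒m<n∨m≡n x<1+k
  ... | inj₁ x<k = fixes x x<k
  ... | inj₂ x≡k = fixes-k x x≡k

  -- A form vanishing at 𝕀 vanishes on matrices of basis rows (sort them by row swaps, or find two
  -- equal rows), and then everywhere, by expanding one row at a time in the standard basis.
  module _ (D𝕀≡0 : D 𝕀 ≡ 0ᵍ) where

    BasisVanishesFrom : ℕ → Set
    BasisVanishesFrom k = ∀ σ → FixesBelow k σ → D (basisMatrix σ) ≡ 0ᵍ

    fixed-at : ∀ {k} (f : Fin n → Fin n) (r : Fin n) → toℕ r ≡ k → f r ≡ r → ∀ z → toℕ z ≡ k → f z ≡ z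
    fixed-at f r r≡k fr≡r z z≡k with toℕ-injective {i = z} {j = r} (trans z≡k (sym r≡k))
    ... | refl = fr≡r

    put-in-place : ∀ {k} (r : Fin n) → toℕ r ≡ k → BasisVanishesFrom (suc k) →
                   ∀ σ → FixesBelow k σ → ∀ x → σ x ≡ r → D (basisMatrix σ) ≡ 0ᵍ
    put-in-place r r≡k vanishes σ fixes x σx≡r with x ≟ r
    ... | yes refl = vanishes σ (fixesBelow-suc σ fixes (fixed-at σ r r≡k σx≡r))
    ... | no x≢r = zero-if-negation-zero _ (begin
      -ᵍ D (basisMatrix σ)              ≡⟨ swap-rows (basisMatrix σ) (x≢r ∘ sym) (λ N → equal-rows N (x≢r ∘ sym)) ⟨
      D (swapAt (basisMatrix σ) r x)    ≡⟨ resp-≋ (λ z → cong-app (map-swapAt δ σ r x z)) ⟨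
      D (basisMatrix (swapAt σ r x))
        ≡⟨ vanishes (swapAt σ r x) (fixesBelow-suc (swapAt σ r x) fixes′ (fixed-at (swapAt σ r x) r r≡k σ′r≡r)) ⟩
      0ᵍ                                ∎)
      where
      open ≡-Reasoning
      σ′r≡r : swapAt σ r x r ≡ r
      σ′r≡r = trans (swapAt-first σ (x≢r ∘ sym)) σx≡r
      fixes′ : FixesBelow _ (swapAt σ r x)
      fixes′ z z<k = trans (swapAt-other σ z≢r z≢x) (fixes z z<k)
        where
        z≢r : z ≢ r
        z≢r z≡r = ℕ.<-irrefl (trans (cong toℕ z≡r) r≡k) z<k
        z≢x : z ≢ x
        z≢x z≡x = z≢r (trans (sym (fixes z z<k)) (trans (cong σ z≡x) σx≡r))

    place-next : ∀ {k} (r : Fin n) → toℕ r ≡ k → BasisVanishesFrom (suc k) → BasisVanishesFrom k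
    place-next r r≡k vanishes σ fixes with any? (λ x → σ x ≟ r)
    ... | yes (x , σx≡r) = put-in-place r r≡k vanishes σ fixes x σx≡r
    ... | no r∉σ with missed-value⇒collision σ r (λ x σx≡r → r∉σ (x , σx≡r))
    ...   | x , y , x≢y , σx≡σy = equal-rows (basisMatrix σ) x≢y (λ c → cong (λ z → δ z c) σx≡σy)

    basis-vanishes-from : ∀ d k → d ℕ.+ k ≡ n → BasisVanishesFrom k
    basis-vanishes-from zero k refl σ fixes =
      trans (resp-≋ (λ x c → cong (λ y → δ y c) (fixes x (toℕ<n x)))) D𝕀≡0
    basis-vanishes-from (suc d) k 1+d+k≡n =
      place-next (fromℕ< k<n) (toℕ-fromℕ< k<n) (basis-vanishes-from d (suc k) (trans (ℕ.+-suc d k) 1+d+k≡n))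
      where
      k<n : k ℕ.< n
      k<n = subst (k ℕ.<_) 1+d+k≡n (ℕ.m<n+m k ℕ.z<s)

    vanishes-from : ∀ m → m ℕ.≤ n → ∀ M σ → (∀ x → m ℕ.≤ toℕ x → M x ≗ δ (σ x)) → D M ≡ 0ᵍ
    vanishes-from zero    _     M σ basis-rows =
      trans (resp-≋ (λ x → basis-rows x ℕ.z≤n)) (basis-vanishes-from n 0 (ℕ.+-identityʳ n) σ (λ _ ()))
    vanishes-from (suc m) 1+m≤n M σ basis-rows = begin
      D M                                                        ≡⟨ resp-≋ expand-row ⟩
      D (setRow M r (λ c → Σᵍ (λ l → M r l *ᵍ δ l c)))           ≡⟨ row-Σ M r (M r) δ ⟩
      Σᵍ (λ l → M r l *ᵍ D (setRow M r (δ l)))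
        ≡⟨ Σᵍ-zero _ (λ l → trans (cong (M r l *ᵍ_) (basis-at l)) (*ᵍ-zeroʳ (M r l))) ⟩
      0ᵍ                                                         ∎
      where
      open ≡-Reasoning
      r : Fin n
      r = fromℕ< 1+m≤n
      expand-row : M ≋ setRow M r (λ c → Σᵍ (λ l → M r l *ᵍ δ l c))
      expand-row x c = trans (sym (cong-app (updateAt-id-local r M refl x) c)) (setRow-cong M r (λ c → sym (Σᵍ-δ (M r) c)) x c)
      basis-at : ∀ l → D (setRow M r (δ l)) ≡ 0ᵍ
      basis-at l = vanishes-from m (ℕ.<⇒≤ 1+m≤n) (setRow M r (δ l)) (updateAt σ r (const l)) rows
        where
        above : ∀ {x} → x ≢ r → m ℕ.≤ toℕ x → suc m ℕ.≤ toℕ x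
        above {x} x≢r m≤x with ℕ.m≤n⇒m<n∨m≡n m≤x
        ... | inj₁ m<x = m<x
        ... | inj₂ m≡x = ⊥-elim (x≢r (toℕ-injective (trans (sym m≡x) (sym (toℕ-fromℕ< 1+m≤n)))))

        rows : ∀ x → m ℕ.≤ toℕ x → setRow M r (δ l) x ≗ δ (updateAt σ r (const l) x)
        rows x m≤x with x ≟ r
        ... | yes refl = λ c → trans (cong-app (updateAt-updates r M) c) (cong (λ y → δ y c) (sym (updateAt-updates r σ)))
        ... | no x≢r = λ c → trans (cong-app (updateAt-minimal x r M x≢r) c)
                            (trans (basis-rows x (above x≢r m≤x) c) (cong (λ y → δ y c) (sym (updateAt-minimal x r σ x≢r))))
    vanishes : ∀ M → D M ≡ 0ᵍ
    vanishes M = vanishes-from n ℕ.≤-refl M (λ x → x) (λ x n≤x → ⊥-elim (ℕ.<⇒≱ (toℕ<n x) n≤x))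

det-equal-rows : ∀ {n} (M : Mat n n) {a b} → a ≢ b → M a ≗ M b → det M ≡ 0ᵍ
det-equal-rows M = Vanishing.equal-rows det-isAlternatingMultilinear M

-- D M − det M · D 𝕀 is again alternating multilinear and vanishes at 𝕀.
det-unique : ∀ {n} {D : Mat n n → ℤ[i]} → IsAlternatingMultilinear D → ∀ M → D M ≡ det M *ᵍ D 𝕀
det-unique {n} {D} isD M = begin
  D M                                                   ≡⟨ shift (D M) (det M *ᵍ D 𝕀) ⟩
  (D M +ᵍ (-ᵍ (det M *ᵍ D 𝕀))) +ᵍ (det M *ᵍ D 𝕀)        ≡⟨ cong (_+ᵍ (det M *ᵍ D 𝕀)) (Vanishing.vanishes isF F𝕀≡0 M) ⟩
  0ᵍ +ᵍ (det M *ᵍ D 𝕀)                                  ≡⟨ +ᵍ-identityˡ (det M *ᵍ D 𝕀) ⟩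
  det M *ᵍ D 𝕀                                          ∎
  where
  open ≡-Reasoning
  open IsAlternatingMultilinear isD
  module det = IsAlternatingMultilinear (det-isAlternatingMultilinear {n})
  F : Mat n n → ℤ[i]
  F M = D M +ᵍ (-ᵍ (det M *ᵍ D 𝕀))
  shift : ∀ x y → x ≡ (x +ᵍ (-ᵍ y)) +ᵍ y
  shift = solve-∀ ℤ[i]-ring
  regroup : ∀ a x y dx dy d →
    ((a *ᵍ x) +ᵍ y) +ᵍ (-ᵍ (((a *ᵍ dx) +ᵍ dy) *ᵍ d)) ≡ (a *ᵍ (x +ᵍ (-ᵍ (dx *ᵍ d)))) +ᵍ (y +ᵍ (-ᵍ (dy *ᵍ d)))
  regroup = solve-∀ ℤ[i]-ring
  annihilate : ∀ d → 0ᵍ +ᵍ (-ᵍ (0ᵍ *ᵍ d)) ≡ 0ᵍ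
  annihilate = solve-∀ ℤ[i]-ring
  cancel : ∀ d → d +ᵍ (-ᵍ (1ᵍ *ᵍ d)) ≡ 0ᵍ
  cancel = solve-∀ ℤ[i]-ring
  isF : IsAlternatingMultilinear F
  isF = record
    { resp-≋        = λ M≋N → cong₂ (λ x y → x +ᵍ (-ᵍ (y *ᵍ D 𝕀))) (resp-≋ M≋N) (det-cong M≋N)
    ; row-linear    = λ M r a u v →
        trans (cong₂ (λ x y → x +ᵍ (-ᵍ (y *ᵍ D 𝕀))) (row-linear M r a u v) (det-row-linear M r a u v))
              (regroup a (D (setRow M r u)) (D (setRow M r v)) (det (setRow M r u)) (det (setRow M r v)) (D 𝕀))
    ; adjacent-rows = λ M a b b≡1+a rows≡ →
        trans (cong₂ (λ x y → x +ᵍ (-ᵍ (y *ᵍ D 𝕀))) (adjacent-rows M a b b≡1+a rows≡) (det.adjacent-rows M a b b≡1+a rows≡))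
              (annihilate (D 𝕀))
    }
  F𝕀≡0 : F 𝕀 ≡ 0ᵍ
  F𝕀≡0 = trans (cong (λ x → D 𝕀 +ᵍ (-ᵍ (x *ᵍ D 𝕀))) (det-𝕀 {n})) (cancel (D 𝕀))

setRow-⊗ : ∀ {n} (Y X : Mat n n) r w → setRow Y r w ⊗ X ≋ setRow (Y ⊗ X) r (λ c → Σᵍ (λ l → w l *ᵍ X l c))
setRow-⊗ Y X r w x c with x ≟ r
... | yes refl = trans (Σᵍ-cong (λ l → cong (λ y → y l *ᵍ X l c) (updateAt-updates r Y)))
                       (sym (cong-app (updateAt-updates r (Y ⊗ X)) c))
... | no x≢r   = trans (Σᵍ-cong (λ l → cong (λ y → y l *ᵍ X l c) (updateAt-minimal x r Y x≢r)))
                       (sym (cong-app (updateAt-minimal x r (Y ⊗ X) x≢r) c))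

𝕀-⊗ : ∀ {n} (X : Mat n n) → 𝕀 ⊗ X ≋ X
𝕀-⊗ X r c = trans (Σᵍ-single (λ l → δ r l *ᵍ X l c) r
                              (λ l l≢r → trans (cong (_*ᵍ X l c) (δ-≢ (l≢r ∘ sym))) (*ᵍ-zeroˡ (X l c))))
                  (trans (cong (_*ᵍ X r c) (δ-refl r)) (*ᵍ-identityˡ (X r c)))

det-⊗ : ∀ {n} (Y X : Mat n n) → det (Y ⊗ X) ≡ det Y *ᵍ det X
det-⊗ {n} Y X = trans (det-unique isD Y) (cong (det Y *ᵍ_) (det-cong (𝕀-⊗ X)))
  where
  module det = IsAlternatingMultilinear (det-isAlternatingMultilinear {n})
  linear-entries : ∀ a (u v : Vecᵍ n) c →
    Σᵍ (λ l → ((a *ᵍ u l) +ᵍ v l) *ᵍ X l c) ≡ (a *ᵍ Σᵍ (λ l → u l *ᵍ X l c)) +ᵍ Σᵍ (λ l → v l *ᵍ X l c)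
  linear-entries a u v c = trans (Σᵍ-cong (λ l → distribute a (u l) (v l) (X l c))) (Σᵍ-linear a _ _)
    where
    distribute : ∀ a x y z → ((a *ᵍ x) +ᵍ y) *ᵍ z ≡ (a *ᵍ (x *ᵍ z)) +ᵍ (y *ᵍ z)
    distribute = solve-∀ ℤ[i]-ring
  isD : IsAlternatingMultilinear (λ Y → det (Y ⊗ X))
  isD = record
    { resp-≋        = λ Y≋Z → det-cong (λ r c → Σᵍ-cong (λ l → cong (_*ᵍ X l c) (Y≋Z r l)))
    ; row-linear    = λ Y r a u v → begin
        det (setRow Y r (λ c → (a *ᵍ u c) +ᵍ v c) ⊗ X)
          ≡⟨ det-cong (λ x c → trans (setRow-⊗ Y X r _ x c) (setRow-cong (Y ⊗ X) r (linear-entries a u v) x c)) ⟩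
        det (setRow (Y ⊗ X) r (λ c → (a *ᵍ Σᵍ (λ l → u l *ᵍ X l c)) +ᵍ Σᵍ (λ l → v l *ᵍ X l c)))
          ≡⟨ det-row-linear (Y ⊗ X) r a _ _ ⟩
        (a *ᵍ det (setRow (Y ⊗ X) r (λ c → Σᵍ (λ l → u l *ᵍ X l c)))) +ᵍ det (setRow (Y ⊗ X) r (λ c → Σᵍ (λ l → v l *ᵍ X l c)))
          ≡⟨ cong₂ (λ x y → (a *ᵍ x) +ᵍ y) (det-cong (setRow-⊗ Y X r u)) (det-cong (setRow-⊗ Y X r v)) ⟨
        (a *ᵍ det (setRow Y r u ⊗ X)) +ᵍ det (setRow Y r v ⊗ X) ∎
    ; adjacent-rows = λ Y a b b≡1+a rows≡ →
        det.adjacent-rows (Y ⊗ X) a b b≡1+a (λ c → Σᵍ-cong (λ l → cong (_*ᵍ X l c) (rows≡ l)))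
    }
    where open ≡-Reasoning

Πᵍ : ∀ {n} → (Fin n → ℤ[i]) → ℤ[i]
Πᵍ {zero}  s = 1ᵍ
Πᵍ {suc n} s = s zero *ᵍ Πᵍ (s ∘ suc)

det-scaleRows : ∀ {n} (s : Fin n → ℤ[i]) (N : Mat n n) → det (λ r c → s r *ᵍ N r c) ≡ Πᵍ s *ᵍ det N
det-scaleRows {zero}  s N = sym (*ᵍ-identityˡ 1ᵍ)
det-scaleRows {suc n} s N = begin
  Σᵍ (λ j → sgn j *ᵍ ((s zero *ᵍ N zero j) *ᵍ det (λ r c → s (suc r) *ᵍ minor N j r c)))
    ≡⟨ Σᵍ-cong (λ j → cong (λ x → sgn j *ᵍ ((s zero *ᵍ N zero j) *ᵍ x)) (det-scaleRows (s ∘ suc) (minor N j))) ⟩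
  Σᵍ (λ j → sgn j *ᵍ ((s zero *ᵍ N zero j) *ᵍ (Πᵍ (s ∘ suc) *ᵍ det (minor N j))))
    ≡⟨ Σᵍ-cong (λ j → factor (sgn j) (s zero) (N zero j) (Πᵍ (s ∘ suc)) (det (minor N j))) ⟩
  Σᵍ (λ j → Πᵍ s *ᵍ (sgn j *ᵍ (N zero j *ᵍ det (minor N j))))
    ≡⟨ *ᵍ-distribˡ-Σᵍ (Πᵍ s) (λ j → sgn j *ᵍ (N zero j *ᵍ det (minor N j))) ⟨
  Πᵍ s *ᵍ det N ∎
  where
  open ≡-Reasoning
  factor : ∀ σ a x p d → σ *ᵍ ((a *ᵍ x) *ᵍ (p *ᵍ d)) ≡ (a *ᵍ p) *ᵍ (σ *ᵍ (x *ᵍ d))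
  factor = solve-∀ ℤ[i]-ring

det-scaleColumns : ∀ {n} (N : Mat n n) (s : Fin n → ℤ[i]) → det (λ r c → N r c *ᵍ s c) ≡ det N *ᵍ Πᵍ s
det-scaleColumns N s = begin
  det (λ r c → N r c *ᵍ s c)          ≡⟨ det-ᵀ (λ r c → N r c *ᵍ s c) ⟨
  det (λ r c → N c r *ᵍ s r)          ≡⟨ det-cong (λ r c → *ᵍ-comm (N c r) (s r)) ⟩
  det (λ r c → s r *ᵍ N c r)          ≡⟨ det-scaleRows s (N ᵀ) ⟩
  Πᵍ s *ᵍ det (N ᵀ)                   ≡⟨ cong (Πᵍ s *ᵍ_) (det-ᵀ N) ⟩
  Πᵍ s *ᵍ det N                       ≡⟨ *ᵍ-comm (Πᵍ s) (det N) ⟩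
  det N *ᵍ Πᵍ s                       ∎
  where open ≡-Reasoning

^ᵍ-+ : ∀ x a b → x ^ᵍ (a ℕ.+ b) ≡ (x ^ᵍ a) *ᵍ (x ^ᵍ b)
^ᵍ-+ x zero    b = sym (*ᵍ-identityˡ (x ^ᵍ b))
^ᵍ-+ x (suc a) b = trans (cong (x *ᵍ_) (^ᵍ-+ x a b)) (sym (*ᵍ-assoc x (x ^ᵍ a) (x ^ᵍ b)))

2ᵍ*-cancelˡ : ∀ {u v} → 2ᵍ *ᵍ u ≡ 2ᵍ *ᵍ v → u ≡ v
2ᵍ*-cancelˡ {a + b i} {c + d i} 2u≡2v =
  ℤ[i]-ext (ℤ.*-cancelˡ-≡ (+ 2) a c (trans (sym (re-double a b)) (trans (cong re 2u≡2v) (re-double c d))))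
           (ℤ.*-cancelˡ-≡ (+ 2) b d (trans (sym (im-double a b)) (trans (cong im 2u≡2v) (im-double c d))))
  where
  re-double : ∀ a b → + 2 * a - + 0 * b ≡ + 2 * a
  re-double = ℤ-solve-∀
  im-double : ∀ a b → + 2 * b ℤ.+ + 0 * a ≡ + 2 * b
  im-double = ℤ-solve-∀

2ᵍ^*-cancelˡ : ∀ m {u v} → (2ᵍ ^ᵍ m) *ᵍ u ≡ (2ᵍ ^ᵍ m) *ᵍ v → u ≡ v
2ᵍ^*-cancelˡ zero    {u} {v} eq = trans (sym (*ᵍ-identityˡ u)) (trans eq (*ᵍ-identityˡ v))
2ᵍ^*-cancelˡ (suc m) {u} {v} eq = 2ᵍ^*-cancelˡ m (2ᵍ*-cancelˡ
  (trans (sym (*ᵍ-assoc 2ᵍ (2ᵍ ^ᵍ m) u)) (trans eq (*ᵍ-assoc 2ᵍ (2ᵍ ^ᵍ m) v))))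

Πᵍ-const : ∀ n x → Πᵍ {n} (λ _ → x) ≡ x ^ᵍ n
Πᵍ-const zero    x = refl
Πᵍ-const (suc n) x = cong (x *ᵍ_) (Πᵍ-const n x)

-- Reduction modulo 1 + i

parity : ℤ → Bool
parity x = (ℤ.∣ x ∣ % 2) ℕ.≡ᵇ 1

bit : Bool → ℤ
bit false = + 0
bit true  = + 1

parity-bit+2* : ∀ b q → parity (bit b ℤ.+ q * + 2) ≡ b
parity-bit+2* false q = cong (λ k → k ℕ.≡ᵇ 1)
  (trans (cong (λ x → ℤ.∣ x ∣ % 2) (ℤ.+-identityˡ (q * + 2)))
         (trans (cong (_% 2) (ℤ.abs-* q (+ 2))) (ℕ.m*n%n≡0 ℤ.∣ q ∣ 2)))
parity-bit+2* true (+ m) = cong (λ k → k ℕ.≡ᵇ 1)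
  (trans (cong (λ x → ℤ.∣ + 1 ℤ.+ x ∣ % 2) (sym (ℤ.pos-* m 2))) (ℕ.[m+kn]%n≡m%n 1 m 2))
parity-bit+2* true -[1+ m ] = trans (cong parity (negated (+ m)))
  (trans (cong (λ k → k % 2 ℕ.≡ᵇ 1) (ℤ.∣-i∣≡∣i∣ (+ 1 ℤ.+ + m * + 2))) (parity-bit+2* true (+ m)))
  where
  negated : ∀ y → + 1 ℤ.+ (ℤ.- (+ 1 ℤ.+ y)) * + 2 ≡ ℤ.- (+ 1 ℤ.+ y * + 2)
  negated = ℤ-solve-∀

parity-decompose : ∀ x → ∃ λ q → x ≡ bit (parity x) ℤ.+ q * + 2
parity-decompose x with x ℤ.% + 2 | ℤ.n%d<d x (+ 2) | ℤ.a≡a%n+[a/n]*n x (+ 2)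
... | 0 | _ | x≡ = x ℤ./ + 2 , subst (λ b → x ≡ bit b ℤ.+ (x ℤ./ + 2) * + 2)
                                     (sym (trans (cong parity x≡) (parity-bit+2* false (x ℤ./ + 2)))) x≡
... | 1 | _ | x≡ = x ℤ./ + 2 , subst (λ b → x ≡ bit b ℤ.+ (x ℤ./ + 2) * + 2)
                                     (sym (trans (cong parity x≡) (parity-bit+2* true (x ℤ./ + 2)))) x≡
... | suc (suc _) | ℕ.s≤s (ℕ.s≤s ()) | _

parity-+2* : ∀ x q → parity (x ℤ.+ q * + 2) ≡ parity x
parity-+2* x q with parity-decompose x
... | p , x≡ = trans (cong (λ y → parity (y ℤ.+ q * + 2)) x≡)
                     (trans (cong parity (regroup (bit (parity x)) p q)) (parity-bit+2* (parity x) (p ℤ.+ q)))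
  where
  regroup : ∀ b p q → (b ℤ.+ p * + 2) ℤ.+ q * + 2 ≡ b ℤ.+ (p ℤ.+ q) * + 2
  regroup = ℤ-solve-∀

parity-+ : ∀ x y → parity (x ℤ.+ y) ≡ parity x xor parity y
parity-+ x y with parity-decompose x | parity-decompose y
... | p , x≡ | q , y≡ = begin
  parity (x ℤ.+ y)                              ≡⟨ cong parity (cong₂ ℤ._+_ x≡ y≡) ⟩
  parity ((a ℤ.+ p * + 2) ℤ.+ (b ℤ.+ q * + 2))  ≡⟨ cong parity (regroup a b p q) ⟩
  parity ((a ℤ.+ b) ℤ.+ (p ℤ.+ q) * + 2)        ≡⟨ parity-+2* (a ℤ.+ b) (p ℤ.+ q) ⟩
  parity (a ℤ.+ b)                              ≡⟨ bits (parity x) (parity y) ⟩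
  parity x xor parity y                         ∎
  where
  open ≡-Reasoning
  a b : ℤ
  a = bit (parity x)
  b = bit (parity y)
  regroup : ∀ a b p q → (a ℤ.+ p * + 2) ℤ.+ (b ℤ.+ q * + 2) ≡ (a ℤ.+ b) ℤ.+ (p ℤ.+ q) * + 2
  regroup = ℤ-solve-∀
  bits : ∀ u v → parity (bit u ℤ.+ bit v) ≡ u xor v
  bits false false = refl
  bits false true  = refl
  bits true  false = refl
  bits true  true  = refl

parity-* : ∀ x y → parity (x * y) ≡ parity x ∧ parity y
parity-* x y with parity-decompose x | parity-decompose y
... | p , x≡ | q , y≡ = begin
  parity (x * y)                                ≡⟨ cong parity (cong₂ _*_ x≡ y≡) ⟩
  parity ((a ℤ.+ p * + 2) * (b ℤ.+ q * + 2))    ≡⟨ cong parity (regroup a b p q) ⟩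
  parity (a * b ℤ.+ carry * + 2)                ≡⟨ parity-+2* (a * b) carry ⟩
  parity (a * b)                                ≡⟨ bits (parity x) (parity y) ⟩
  parity x ∧ parity y                           ∎
  where
  open ≡-Reasoning
  a b carry : ℤ
  a = bit (parity x)
  b = bit (parity y)
  carry = a * q ℤ.+ p * b ℤ.+ p * q * + 2
  regroup : ∀ a b p q → (a ℤ.+ p * + 2) * (b ℤ.+ q * + 2) ≡ a * b ℤ.+ (a * q ℤ.+ p * b ℤ.+ p * q * + 2) * + 2
  regroup = ℤ-solve-∀
  bits : ∀ u v → parity (bit u * bit v) ≡ u ∧ v
  bits false false = refl
  bits false true  = refl
  bits true  false = refl
  bits true  true  = refl

red-+ᵍ : ∀ z w → red (z +ᵍ w) ≡ red z xor red w
red-+ᵍ (a + b i) (c + d i) = trans (cong parity (regroup a b c d)) (parity-+ (a ℤ.+ b) (c ℤ.+ d))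
  where
  regroup : ∀ a b c d → (a ℤ.+ c) ℤ.+ (b ℤ.+ d) ≡ (a ℤ.+ b) ℤ.+ (c ℤ.+ d)
  regroup = ℤ-solve-∀

red-*ᵍ : ∀ z w → red (z *ᵍ w) ≡ red z ∧ red w
red-*ᵍ (a + b i) (c + d i) = begin
  parity ((a * c - b * d) ℤ.+ (a * d ℤ.+ b * c))               ≡⟨ cong parity (regroup a b c d) ⟩
  parity ((a ℤ.+ b) * (c ℤ.+ d) ℤ.+ (ℤ.- (b * d)) * + 2)       ≡⟨ parity-+2* ((a ℤ.+ b) * (c ℤ.+ d)) (ℤ.- (b * d)) ⟩
  parity ((a ℤ.+ b) * (c ℤ.+ d))                               ≡⟨ parity-* (a ℤ.+ b) (c ℤ.+ d) ⟩
  parity (a ℤ.+ b) ∧ parity (c ℤ.+ d)                          ∎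
  where
  open ≡-Reasoning
  regroup : ∀ a b c d → (a * c - b * d) ℤ.+ (a * d ℤ.+ b * c) ≡ (a ℤ.+ b) * (c ℤ.+ d) ℤ.+ (ℤ.- (b * d)) * + 2
  regroup = ℤ-solve-∀

red-conj : ∀ z → red (conj z) ≡ red z
red-conj (a + b i) = trans (cong parity (regroup a b)) (parity-+2* (a ℤ.+ b) (ℤ.- b))
  where
  regroup : ∀ a b → a ℤ.+ (ℤ.- b) ≡ (a ℤ.+ b) ℤ.+ (ℤ.- b) * + 2
  regroup = ℤ-solve-∀

red-Σᵍ : ∀ {n} (f : Fin n → ℤ[i]) → red (Σᵍ f) ≡ Σ₂ (red ∘ f)
red-Σᵍ {zero}  f = refl
red-Σᵍ {suc n} f = trans (red-+ᵍ (f zero) (Σᵍ (f ∘ suc))) (cong (red (f zero) xor_) (red-Σᵍ (f ∘ suc)))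

Odd⇒red≡true : ∀ z → Odd z → red z ≡ true
Odd⇒red≡true (a + b i) odd with parity-decompose (a ℤ.+ b)
... | q , a+b≡ with parity (a ℤ.+ b)
...   | true  = refl
...   | false = ⊥-elim (odd (divides ℤ.∣ q - b ∣ (trans (cong ℤ.∣_∣ (difference a b q a+b≡)) (ℤ.abs-* (q - b) (+ 2)))))
  where
  difference : ∀ a b q → a ℤ.+ b ≡ + 0 ℤ.+ q * + 2 → a - b ≡ (q - b) * + 2
  difference a b q a+b≡ = trans (shift a b) (trans (cong (λ x → x - b * + 2) a+b≡) (simplify q b))
    where
    shift : ∀ a b → a - b ≡ (a ℤ.+ b) - b * + 2
    shift = ℤ-solve-∀
    simplify : ∀ q b → (+ 0 ℤ.+ q * + 2) - b * + 2 ≡ (q - b) * + 2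
    simplify = ℤ-solve-∀

red-det-evenRow : ∀ {n} (M : Mat n n) r → (∀ c → red (M r c) ≡ false) → red (det M) ≡ false
red-det-evenRow {suc n} M r row-even = trans (red-Σᵍ (λ j → sgn j *ᵍ (M zero j *ᵍ det (minor M j)))) (Σ₂-zero _ term-even)
  where
  red-term : ∀ j → red (sgn j *ᵍ (M zero j *ᵍ det (minor M j))) ≡ red (sgn j) ∧ (red (M zero j) ∧ red (det (minor M j)))
  red-term j = trans (red-*ᵍ (sgn j) _) (cong (red (sgn j) ∧_) (red-*ᵍ (M zero j) _))
  factor-even : ∀ r → (∀ c → red (M r c) ≡ false) → ∀ j → red (M zero j) ≡ false ⊎ red (det (minor M j)) ≡ false
  factor-even zero     row-even j = inj₁ (row-even j)
  factor-even (suc r′) row-even j = inj₂ (red-det-evenRow (minor M j) r′ (row-even ∘ punchIn j))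
  term-even : ∀ j → red (sgn j *ᵍ (M zero j *ᵍ det (minor M j))) ≡ false
  term-even j with factor-even r row-even j
  ... | inj₁ x≡false = trans (red-term j) (trans (cong (λ b → red (sgn j) ∧ (b ∧ red (det (minor M j)))) x≡false) (∧-zeroʳ (red (sgn j))))
  ... | inj₂ y≡false = trans (red-term j) (trans (cong (λ b → red (sgn j) ∧ (red (M zero j) ∧ b)) y≡false)
                                                 (trans (cong (red (sgn j) ∧_) (∧-zeroʳ (red (M zero j)))) (∧-zeroʳ (red (sgn j)))))

-- Walk counts are even

Even : ℤ[i] → Set
Even z = ∃ λ w → z ≡ 2ᵍ *ᵍ w

Even-0ᵍ : Even 0ᵍ
Even-0ᵍ = 0ᵍ , refl

Even-+ᵍ : ∀ {z w} → Even z → Even w → Even (z +ᵍ w)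
Even-+ᵍ (x , z≡2x) (y , w≡2y) = x +ᵍ y , trans (cong₂ _+ᵍ_ z≡2x w≡2y) (sym (*ᵍ-distribˡ-+ᵍ 2ᵍ x y))

Even-Σᵍ : ∀ {n} (f : Fin n → ℤ[i]) → (∀ j → Even (f j)) → Even (Σᵍ f)
Even-Σᵍ {zero}  f even = Even-0ᵍ
Even-Σᵍ {suc n} f even = Even-+ᵍ (even zero) (Even-Σᵍ (f ∘ suc) (even ∘ suc))

Even-+conj : ∀ z → Even (z +ᵍ conj z)
Even-+conj (a + b i) = a + (+ 0) i , ℤ[i]-ext (re-double a) (im-double a b)
  where
  re-double : ∀ a → a ℤ.+ a ≡ + 2 * a - + 0 * + 0
  re-double = ℤ-solve-∀
  im-double : ∀ a b → b ℤ.+ ℤ.- b ≡ + 2 * + 0 ℤ.+ + 0 * a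
  im-double = ℤ-solve-∀

Even-Σᵍ-hermitian : ∀ {n} (g : Fin n → Fin n → ℤ[i]) → (∀ u v → g v u ≡ conj (g u v)) → (∀ u → g u u ≡ 0ᵍ) →
                    Even (Σᵍ (λ u → Σᵍ (g u)))
Even-Σᵍ-hermitian {zero}  g hermitian diagonal = Even-0ᵍ
Even-Σᵍ-hermitian {suc n} g hermitian diagonal = subst Even (sym split)
  (Even-+ᵍ (Even-+conj T) (Even-+ᵍ (0ᵍ , diagonal zero)
    (Even-Σᵍ-hermitian (λ u v → g (suc u) (suc v)) (λ u v → hermitian (suc u) (suc v)) (diagonal ∘ suc))))
  where
  open ≡-Reasoning
  T : ℤ[i]
  T = Σᵍ (g zero ∘ suc)
  rest : ℤ[i]
  rest = Σᵍ (λ u → Σᵍ (λ v → g (suc u) (suc v)))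
  split : Σᵍ (λ u → Σᵍ (g u)) ≡ (T +ᵍ conj T) +ᵍ (g zero zero +ᵍ rest)
  split = begin
    (g zero zero +ᵍ T) +ᵍ Σᵍ (λ u → g (suc u) zero +ᵍ Σᵍ (λ v → g (suc u) (suc v)))
      ≡⟨ cong ((g zero zero +ᵍ T) +ᵍ_) (Σᵍ-distrib-+ᵍ (λ u → g (suc u) zero) (λ u → Σᵍ (λ v → g (suc u) (suc v)))) ⟩
    (g zero zero +ᵍ T) +ᵍ (Σᵍ (λ u → g (suc u) zero) +ᵍ rest)
      ≡⟨ cong (λ x → (g zero zero +ᵍ T) +ᵍ (x +ᵍ rest)) (trans (Σᵍ-cong (λ u → hermitian zero (suc u))) (sym (conj-Σᵍ (g zero ∘ suc)))) ⟩
    (g zero zero +ᵍ T) +ᵍ (conj T +ᵍ rest)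
      ≡⟨ rearrange (g zero zero) T (conj T) rest ⟩
    (T +ᵍ conj T) +ᵍ (g zero zero +ᵍ rest) ∎
    where
    rearrange : ∀ a b c d → (a +ᵍ b) +ᵍ (c +ᵍ d) ≡ (b +ᵍ c) +ᵍ (a +ᵍ d)
    rearrange = solve-∀ ℤ[i]-ring

square-parity : ∀ a → ∃ λ h → a * a ≡ a ℤ.+ h * + 2
square-parity a with parity-decompose a
... | q , a≡ with parity a
...   | false = q * q * + 2 - q , trans (cong (λ x → x * x) a≡) (trans (even-square q) (cong (ℤ._+ (q * q * + 2 - q) * + 2) (sym a≡)))
  where
  even-square : ∀ q → (+ 0 ℤ.+ q * + 2) * (+ 0 ℤ.+ q * + 2) ≡ (+ 0 ℤ.+ q * + 2) ℤ.+ (q * q * + 2 - q) * + 2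
  even-square = ℤ-solve-∀
...   | true  = q ℤ.+ q * q * + 2 , trans (cong (λ x → x * x) a≡) (trans (odd-square q) (cong (ℤ._+ (q ℤ.+ q * q * + 2) * + 2) (sym a≡)))
  where
  odd-square : ∀ q → (+ 1 ℤ.+ q * + 2) * (+ 1 ℤ.+ q * + 2) ≡ (+ 1 ℤ.+ q * + 2) ℤ.+ (q ℤ.+ q * q * + 2) * + 2
  odd-square = ℤ-solve-∀

i↦1 : ℤ[i] → ℤ[i]
i↦1 z = (re z ℤ.+ im z) + (+ 0) i

i↦1-Σᵍ : ∀ {n} (f : Fin n → ℤ[i]) → i↦1 (Σᵍ f) ≡ Σᵍ (i↦1 ∘ f)
i↦1-Σᵍ {zero}  f = refl
i↦1-Σᵍ {suc n} f = trans (ℤ[i]-ext (regroup (re (f zero)) (im (f zero)) (re (Σᵍ (f ∘ suc))) (im (Σᵍ (f ∘ suc)))) refl)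
                           (cong (i↦1 (f zero) +ᵍ_) (i↦1-Σᵍ (f ∘ suc)))
  where
  regroup : ∀ a b c d → (a ℤ.+ c) ℤ.+ (b ℤ.+ d) ≡ (a ℤ.+ b) ℤ.+ (c ℤ.+ d)
  regroup = ℤ-solve-∀

Even-i↦1 : ∀ {z} → Even z → Even (i↦1 z)
Even-i↦1 {z} ((c + d i) , z≡2w) = (c ℤ.+ d) + (+ 0) i , trans (cong i↦1 z≡2w) (ℤ[i]-ext (re-double c d) (im-double c d))
  where
  re-double : ∀ c d → (+ 2 * c - + 0 * d) ℤ.+ (+ 2 * d ℤ.+ + 0 * c) ≡ + 2 * (c ℤ.+ d) - + 0 * + 0
  re-double = ℤ-solve-∀
  im-double : ∀ c d → + 0 ≡ + 2 * + 0 ℤ.+ + 0 * (c ℤ.+ d)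
  im-double = ℤ-solve-∀

conj-*ᵍ-self-mod-2 : ∀ z → ∃ λ w → conj z *ᵍ z ≡ i↦1 z +ᵍ (2ᵍ *ᵍ w)
conj-*ᵍ-self-mod-2 (a + b i) with square-parity a | square-parity b
... | h , a²≡ | h′ , b²≡ = (h ℤ.+ h′) + (+ 0) i , ℤ[i]-ext re-norm (im-norm a b h h′)
  where
  re-norm : a * a - (ℤ.- b) * b ≡ (a ℤ.+ b) ℤ.+ (+ 2 * (h ℤ.+ h′) - + 0 * + 0)
  re-norm = trans (sum-of-squares a b) (trans (cong₂ ℤ._+_ a²≡ b²≡) (collect a b h h′))
    where
    sum-of-squares : ∀ a b → a * a - (ℤ.- b) * b ≡ a * a ℤ.+ b * b
    sum-of-squares = ℤ-solve-∀
    collect : ∀ a b h h′ → (a ℤ.+ h * + 2) ℤ.+ (b ℤ.+ h′ * + 2) ≡ (a ℤ.+ b) ℤ.+ (+ 2 * (h ℤ.+ h′) - + 0 * + 0)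
    collect = ℤ-solve-∀
  im-norm : ∀ a b h h′ → a * b ℤ.+ (ℤ.- b) * a ≡ + 0 ℤ.+ (+ 2 * + 0 ℤ.+ + 0 * (h ℤ.+ h′))
  im-norm = ℤ-solve-∀

⟪_,_⟫ : ∀ {n} → Vecᵍ n → Vecᵍ n → ℤ[i]
⟪ x , y ⟫ = Σᵍ (λ u → conj (x u) *ᵍ y u)

halves : ∀ l → ∃ λ j → l ≡ j ℕ.+ j ⊎ l ≡ suc (j ℕ.+ j)
halves zero = zero , inj₁ refl
halves (suc l) with halves l
... | j , inj₁ l≡2j   = j , inj₂ (cong suc l≡2j)
... | j , inj₂ l≡2j+1 = suc j , inj₁ (cong suc (trans l≡2j+1 (sym (ℕ.+-suc j j))))

module Walks {n} (A : Mat n n) (hermitian : ∀ u v → A v u ≡ conj (A u v)) (loopless : ∀ u → A u u ≡ 0ᵍ) where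

  walkCount : ℕ → ℤ[i]
  walkCount l = ⟪ 𝟙 , walkVec A l ⟫

  adjoint : ∀ x y → ⟪ A · x , y ⟫ ≡ ⟪ x , A · y ⟫
  adjoint x y = begin
    Σᵍ (λ u → conj (Σᵍ (λ v → A u v *ᵍ x v)) *ᵍ y u)
      ≡⟨ Σᵍ-cong (λ u → trans (cong (_*ᵍ y u) (conj-Σᵍ (λ v → A u v *ᵍ x v))) (*ᵍ-distribʳ-Σᵍ (y u) (λ v → conj (A u v *ᵍ x v)))) ⟩
    Σᵍ (λ u → Σᵍ (λ v → conj (A u v *ᵍ x v) *ᵍ y u))
      ≡⟨ Σᵍ-cong (λ u → Σᵍ-cong (λ v → term u v)) ⟩
    Σᵍ (λ u → Σᵍ (λ v → conj (x v) *ᵍ (A v u *ᵍ y u)))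
      ≡⟨ Σᵍ-comm (λ u v → conj (x v) *ᵍ (A v u *ᵍ y u)) ⟩
    Σᵍ (λ v → Σᵍ (λ u → conj (x v) *ᵍ (A v u *ᵍ y u)))
      ≡⟨ Σᵍ-cong (λ v → *ᵍ-distribˡ-Σᵍ (conj (x v)) (λ u → A v u *ᵍ y u)) ⟨
    Σᵍ (λ v → conj (x v) *ᵍ Σᵍ (λ u → A v u *ᵍ y u)) ∎
    where
    open ≡-Reasoning
    rearrange : ∀ a x y → (a *ᵍ x) *ᵍ y ≡ x *ᵍ (a *ᵍ y)
    rearrange = solve-∀ ℤ[i]-ring
    term : ∀ u v → conj (A u v *ᵍ x v) *ᵍ y u ≡ conj (x v) *ᵍ (A v u *ᵍ y u)
    term u v = trans (cong (_*ᵍ y u) (conj-*ᵍ (A u v) (x v)))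
                     (trans (rearrange (conj (A u v)) (conj (x v)) (y u)) (cong (λ a → conj (x v) *ᵍ (a *ᵍ y u)) (sym (hermitian u v))))

  walk-shift : ∀ a b → ⟪ walkVec A a , walkVec A b ⟫ ≡ walkCount (a ℕ.+ b)
  walk-shift zero    b = refl
  walk-shift (suc a) b = trans (adjoint (walkVec A a) (walkVec A b))
                               (trans (walk-shift a (suc b)) (cong walkCount (ℕ.+-suc a b)))

  walkCount-odd : ∀ j → Even (walkCount (suc (j ℕ.+ j)))
  walkCount-odd j = subst Even (trans (Σᵍ-cong (λ u → sym (*ᵍ-distribˡ-Σᵍ (conj (x u)) (λ v → A u v *ᵍ x v))))
                                           (trans (walk-shift j (suc j)) (cong walkCount (ℕ.+-suc j j))))
                                    (Even-Σᵍ-hermitian g g-hermitian g-diagonal)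
    where
    x : Vecᵍ n
    x = walkVec A j
    g : Fin n → Fin n → ℤ[i]
    g u v = conj (x u) *ᵍ (A u v *ᵍ x v)
    swap-ends : ∀ a b c → a *ᵍ (b *ᵍ c) ≡ c *ᵍ (b *ᵍ a)
    swap-ends = solve-∀ ℤ[i]-ring
    g-hermitian : ∀ u v → g v u ≡ conj (g u v)
    g-hermitian u v = sym (begin
      conj (conj (x u) *ᵍ (A u v *ᵍ x v))
        ≡⟨ trans (conj-*ᵍ (conj (x u)) _) (cong₂ _*ᵍ_ (conj-involutive (x u)) (conj-*ᵍ (A u v) (x v))) ⟩
      x u *ᵍ (conj (A u v) *ᵍ conj (x v))          ≡⟨ cong (λ a → x u *ᵍ (a *ᵍ conj (x v))) (sym (hermitian u v)) ⟩
      x u *ᵍ (A v u *ᵍ conj (x v))                 ≡⟨ swap-ends (x u) (A v u) (conj (x v)) ⟩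
      conj (x v) *ᵍ (A v u *ᵍ x u)                 ∎)
      where open ≡-Reasoning
    g-diagonal : ∀ u → g u u ≡ 0ᵍ
    g-diagonal u = trans (cong (λ a → conj (x u) *ᵍ (a *ᵍ x u)) (loopless u))
                         (trans (cong (conj (x u) *ᵍ_) (*ᵍ-zeroˡ (x u))) (*ᵍ-zeroʳ (conj (x u))))

  walkCount-double : ∀ j → Even (walkCount j) → Even (walkCount (j ℕ.+ j))
  walkCount-double j even = subst Even norms (Even-+ᵍ (Even-i↦1 (subst Even sum≡ even)) (Even-Σᵍ (λ u → 2ᵍ *ᵍ w u) (λ u → w u , refl)))
    where
    open ≡-Reasoning
    x : Vecᵍ n
    x = walkVec A j
    w : Fin n → ℤ[i]
    w u = proj₁ (conj-*ᵍ-self-mod-2 (x u))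
    sum≡ : walkCount j ≡ Σᵍ x
    sum≡ = Σᵍ-cong (λ u → *ᵍ-identityˡ (x u))
    norms : i↦1 (Σᵍ x) +ᵍ Σᵍ (λ u → 2ᵍ *ᵍ w u) ≡ walkCount (j ℕ.+ j)
    norms = begin
      i↦1 (Σᵍ x) +ᵍ Σᵍ (λ u → 2ᵍ *ᵍ w u)                 ≡⟨ cong (_+ᵍ Σᵍ (λ u → 2ᵍ *ᵍ w u)) (i↦1-Σᵍ x) ⟩
      Σᵍ (i↦1 ∘ x) +ᵍ Σᵍ (λ u → 2ᵍ *ᵍ w u)               ≡⟨ Σᵍ-distrib-+ᵍ (i↦1 ∘ x) (λ u → 2ᵍ *ᵍ w u) ⟨
      Σᵍ (λ u → i↦1 (x u) +ᵍ (2ᵍ *ᵍ w u))               ≡⟨ Σᵍ-cong (λ u → proj₂ (conj-*ᵍ-self-mod-2 (x u))) ⟨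
      ⟪ x , x ⟫                                          ≡⟨ walk-shift j j ⟩
      walkCount (j ℕ.+ j)                                ∎

  walkCount-even : ∀ l → 1 ℕ.≤ l → Even (walkCount l)
  walkCount-even = <-rec (λ l → 1 ℕ.≤ l → Even (walkCount l)) step
    where
    step : ∀ l → (∀ {m} → m ℕ.< l → 1 ℕ.≤ m → Even (walkCount m)) → 1 ℕ.≤ l → Even (walkCount l)
    step l rec 1≤l with halves l
    ... | j     , inj₂ l≡2j+1 = subst (Even ∘ walkCount) (sym l≡2j+1) (walkCount-odd j)
    ... | zero  , inj₁ l≡0    = ⊥-elim (ℕ.<-irrefl (sym l≡0) 1≤l)
    ... | suc j , inj₁ l≡2j   = subst (Even ∘ walkCount) (sym l≡2j)
                                  (walkCount-double (suc j) (rec (subst (suc j ℕ.<_) (sym l≡2j) (ℕ.m<m+n (suc j) ℕ.z<s)) (ℕ.s≤s ℕ.z≤n)))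

-- Rank over ℤ[i]/(1 + i)

true≢false : true ≢ false
true≢false ()

HasIndepCols-≤ : ∀ {m k} (M : Fin m → Fin k → Bool) s → HasIndepCols M s → s ℕ.≤ k
HasIndepCols-≤ {k = k} M s (f , independent) with s ≤? k
... | yes s≤k = s≤k
... | no s≰k with pigeonhole (ℕ.≰⇒> s≰k) f
...   | x , y , x<y , fx≡fy = ⊥-elim (true≢false (trans (sym (indicator-at x (inj₁ refl))) (independent indicator combination x)))
  where
  x≢y : x ≢ y
  x≢y x≡y = ℕ.<-irrefl (cong toℕ x≡y) x<y
  indicator : Fin s → Bool
  indicator z = does (z ≟ x) ∨ does (z ≟ y)
  indicator-at : ∀ z → z ≡ x ⊎ z ≡ y → indicator z ≡ true
  indicator-at z (inj₁ refl) = cong (_∨ does (z ≟ y)) (dec-true (z ≟ z) refl)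
  indicator-at z (inj₂ refl) = trans (cong (does (z ≟ x) ∨_) (dec-true (z ≟ z) refl)) (∨-zeroʳ _)
  combination : ∀ r → Σ₂ (λ j → indicator j ∧ M r (f j)) ≡ false
  combination r = begin
    Σ₂ (λ j → indicator j ∧ M r (f j))
      ≡⟨ Σ₂-pair (λ j → indicator j ∧ M r (f j)) x≢y
           (λ j j≢x j≢y → cong (_∧ M r (f j)) (cong₂ _∨_ (dec-false (j ≟ x) j≢x) (dec-false (j ≟ y) j≢y))) ⟩
    (indicator x ∧ M r (f x)) xor (indicator y ∧ M r (f y))
      ≡⟨ cong₂ (λ a b → (a ∧ M r (f x)) xor (b ∧ M r (f y))) (indicator-at x (inj₁ refl)) (indicator-at y (inj₂ refl)) ⟩
    M r (f x) xor M r (f y)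
      ≡⟨ cong (λ z → M r (f x) xor M r z) (sym fx≡fy) ⟩
    M r (f x) xor M r (f x)
      ≡⟨ xor-same (M r (f x)) ⟩
    false ∎
    where open ≡-Reasoning

-- A dependency modulo 1 + i among the chosen columns, written into row f j₀ of Nᵀ, leaves the
-- determinant unchanged but makes it vanish modulo 1 + i.
columns-independent : ∀ {n k} (N : Mat n n) (f : Fin k → Fin n) → (∀ {j j′} → f j ≡ f j′ → j ≡ j′) →
                      red (det N) ≡ true → LinIndep (λ j r → red (N r (f j)))
columns-independent {n} N f f-injective det-odd coef dependent j₀ with coef j₀ in coef-j₀
... | false = refl
... | true  = ⊥-elim (true≢false (trans (sym det-odd) (trans (cong red (sym replaced≡det)) replaced-even)))
  where
  open ≡-Reasoning
  open AlternatingMultilinear (det-isAlternatingMultilinear {n})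
  bitᵍ : Bool → ℤ[i]
  bitᵍ false = 0ᵍ
  bitᵍ true  = 1ᵍ
  red-bitᵍ : ∀ b → red (bitᵍ b) ≡ b
  red-bitᵍ false = refl
  red-bitᵍ true  = refl
  r₀ : Fin n
  r₀ = f j₀
  combination : Vecᵍ n
  combination r = Σᵍ (λ j → bitᵍ (coef j) *ᵍ N r (f j))
  replaced : Mat n n
  replaced = setRow (N ᵀ) r₀ combination
  replaced-even : red (det replaced) ≡ false
  replaced-even = red-det-evenRow replaced r₀ λ r → begin
    red (replaced r₀ r)                             ≡⟨ cong red (cong-app (updateAt-updates r₀ (N ᵀ)) r) ⟩
    red (combination r)                             ≡⟨ red-Σᵍ (λ j → bitᵍ (coef j) *ᵍ N r (f j)) ⟩
    Σ₂ (λ j → red (bitᵍ (coef j) *ᵍ N r (f j)))     ≡⟨ Σ₂-cong (λ j → trans (red-*ᵍ (bitᵍ (coef j)) (N r (f j)))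
                                                                           (cong (_∧ red (N r (f j))) (red-bitᵍ (coef j)))) ⟩
    Σ₂ (λ j → coef j ∧ red (N r (f j)))             ≡⟨ dependent r ⟩
    false                                           ∎
  other-columns : ∀ j → j ≢ j₀ → bitᵍ (coef j) *ᵍ det (setRow (N ᵀ) r₀ ((N ᵀ) (f j))) ≡ 0ᵍ
  other-columns j j≢j₀ = trans (cong (bitᵍ (coef j) *ᵍ_) (det-equal-rows _ (j≢j₀ ∘ sym ∘ f-injective)
                                   (λ c → trans (cong-app (updateAt-updates r₀ (N ᵀ)) c)
                                                (sym (cong-app (updateAt-minimal (f j) r₀ (N ᵀ) (j≢j₀ ∘ f-injective)) c)))))
                               (*ᵍ-zeroʳ (bitᵍ (coef j)))
  replaced≡det : det replaced ≡ det N
  replaced≡det = begin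
    det replaced
      ≡⟨ row-Σ (N ᵀ) r₀ (bitᵍ ∘ coef) (λ j → (N ᵀ) (f j)) ⟩
    Σᵍ (λ j → bitᵍ (coef j) *ᵍ det (setRow (N ᵀ) r₀ ((N ᵀ) (f j))))
      ≡⟨ Σᵍ-single (λ j → bitᵍ (coef j) *ᵍ det (setRow (N ᵀ) r₀ ((N ᵀ) (f j)))) j₀ other-columns ⟩
    bitᵍ (coef j₀) *ᵍ det (setRow (N ᵀ) r₀ ((N ᵀ) r₀))
      ≡⟨ cong₂ (λ b x → bitᵍ b *ᵍ x) coef-j₀ (det-cong (λ x → cong-app (updateAt-id-local r₀ (N ᵀ) refl x))) ⟩
    1ᵍ *ᵍ det (N ᵀ)
      ≡⟨ trans (*ᵍ-identityˡ (det (N ᵀ))) (det-ᵀ N) ⟩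
    det N ∎

-- The walk matrix of a mixed graph

halvingScale : ∀ {n} → ℕ → Fin n → ℤ[i]
halvingScale t c = if does (t ≤? toℕ c) then 2ᵍ else 1ᵍ

Πᵍ-halvingScale : ∀ t m → t ℕ.≤ 1 → Πᵍ {t ℕ.+ m} (halvingScale t) ≡ 2ᵍ ^ᵍ m
Πᵍ-halvingScale zero          m _ = Πᵍ-const m 2ᵍ
Πᵍ-halvingScale (suc zero)    m _ = trans (*ᵍ-identityˡ _) (Πᵍ-const m 2ᵍ)
Πᵍ-halvingScale (suc (suc t)) m (ℕ.s≤s ())

hermAdj-hermitian : ∀ {n} (G : MixedGraph n) u v → hermAdj G v u ≡ conj (hermAdj G u v)
hermAdj-hermitian G u v = trans (cong hEntry (symm G u v)) (flip (rel G u v))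
  where
  flip : ∀ e → hEntry (flipE e) ≡ conj (hEntry e)
  flip none  = refl
  flip undir = refl
  flip out   = refl
  flip inn   = refl

hermAdj-loopless : ∀ {n} (G : MixedGraph n) u → hermAdj G u u ≡ 0ᵍ
hermAdj-loopless G u = cong hEntry (loopless G u)

module Gram {n} (A : Mat n n) (hermitian : ∀ u v → A v u ≡ conj (A u v)) (loopless : ∀ u → A u u ≡ 0ᵍ) where
  open Walks A hermitian loopless

  W H : Mat n n
  W = walkMatrix A
  H = (W *) ⊗ W

  t k : ℕ
  t = n % 2
  k = n / 2

  n≡t+2k : n ≡ t ℕ.+ (k ℕ.+ k)
  n≡t+2k = trans (ℕ.m≡m%n+[m/n]*n n 2) (cong (t ℕ.+_) (trans (ℕ.*-comm k 2) (cong (k ℕ.+_) (ℕ.+-identityʳ k))))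

  H-even : ∀ r c → t ℕ.≤ toℕ c → Even (H r c)
  H-even r c t≤c with toℕ r ℕ.+ toℕ c in r+c≡
  -- Only the walk count of length 0 is not always even: it is e* e = n, and then t = 0.
  ... | suc l = subst Even (sym (trans (walk-shift (toℕ r) (toℕ c)) (cong walkCount r+c≡))) (walkCount-even (suc l) (ℕ.s≤s ℕ.z≤n))
  ... | zero  = subst Even (sym (trans (walk-shift (toℕ r) (toℕ c)) (trans (cong walkCount r+c≡) (count-vertices n))))
                  ((+ k) + (+ 0) i , ℤ[i]-ext (trans (cong +_ n≡2k) (re-double (+ k))) (im-double (+ k)))
    where
    count-vertices : ∀ m → Σᵍ {m} (λ _ → conj 1ᵍ *ᵍ 1ᵍ) ≡ (+ m) + (+ 0) i
    count-vertices zero    = refl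
    count-vertices (suc m) = cong (1ᵍ +ᵍ_) (count-vertices m)
    n≡2k : n ≡ k ℕ.+ k
    n≡2k = trans n≡t+2k (cong (ℕ._+ (k ℕ.+ k)) (ℕ.n≤0⇒n≡0 (subst (t ℕ.≤_) (ℕ.m+n≡0⇒n≡0 (toℕ r) r+c≡) t≤c)))
    re-double : ∀ x → x ℤ.+ x ≡ + 2 * x - + 0 * + 0
    re-double = ℤ-solve-∀
    im-double : ∀ x → + 0 ≡ + 2 * + 0 ℤ.+ + 0 * x
    im-double = ℤ-solve-∀

  half : Mat n n
  half r c with t ≤? toℕ c
  ... | yes t≤c = proj₁ (H-even r c t≤c)
  ... | no  _   = H r c

  half-spec : ∀ r c → t ℕ.≤ toℕ c → 2ᵍ *ᵍ half r c ≡ H r c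
  half-spec r c t≤c with t ≤? toℕ c
  ... | yes t≤c′ = sym (proj₂ (H-even r c t≤c′))
  ... | no  t≰c  = ⊥-elim (t≰c t≤c)

  H-scaled : H ≋ λ r c → half r c *ᵍ halvingScale t c
  H-scaled r c with t ≤? toℕ c in t≤?c
  ... | yes t≤c = trans (proj₂ (H-even r c t≤c))
                  (trans (*ᵍ-comm 2ᵍ (proj₁ (H-even r c t≤c)))
                         (cong (λ d → proj₁ (H-even r c t≤c) *ᵍ (if does d then 2ᵍ else 1ᵍ)) (sym t≤?c)))
  ... | no  _   = trans (sym (*ᵍ-identityʳ (H r c)))
                        (cong (λ d → H r c *ᵍ (if does d then 2ᵍ else 1ᵍ)) (sym t≤?c))

  det-H≡det-half : det H ≡ det half *ᵍ (2ᵍ ^ᵍ (k ℕ.+ k))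
  det-H≡det-half = begin
    det H                                           ≡⟨ det-cong H-scaled ⟩
    det (λ r c → half r c *ᵍ halvingScale t c)       ≡⟨ det-scaleColumns half (halvingScale {n} t) ⟩
    det half *ᵍ Πᵍ (halvingScale {n} t)              ≡⟨ cong (det half *ᵍ_) Πᵍ-scale ⟩
    det half *ᵍ (2ᵍ ^ᵍ (k ℕ.+ k))                    ∎
    where
    open ≡-Reasoning
    Πᵍ-scale : Πᵍ {n} (halvingScale t) ≡ 2ᵍ ^ᵍ (k ℕ.+ k)
    Πᵍ-scale = subst (λ m → Πᵍ {m} (halvingScale t) ≡ 2ᵍ ^ᵍ (k ℕ.+ k)) (sym n≡t+2k)
                     (Πᵍ-halvingScale t (k ℕ.+ k) (ℕ.<⇒≤pred (ℕ.m%n<n n 2)))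

  det-H≡norm : det H ≡ conj (det W) *ᵍ det W
  det-H≡norm = trans (det-⊗ (W *) W) (cong (_*ᵍ det W) (trans (det-conj (W ᵀ)) (cong conj (det-ᵀ W))))

  det-half≡norm : ∀ d → (2ᵍ ^ᵍ k) *ᵍ d ≡ det W → det half ≡ conj d *ᵍ d
  det-half≡norm d 2ᵏd≡detW = 2ᵍ^*-cancelˡ (k ℕ.+ k) (begin
    (2ᵍ ^ᵍ (k ℕ.+ k)) *ᵍ det half                    ≡⟨ *ᵍ-comm (2ᵍ ^ᵍ (k ℕ.+ k)) (det half) ⟩
    det half *ᵍ (2ᵍ ^ᵍ (k ℕ.+ k))                    ≡⟨ det-H≡det-half ⟨
    det H                                          ≡⟨ det-H≡norm ⟩
    conj (det W) *ᵍ det W                          ≡⟨ cong (λ z → conj z *ᵍ z) 2ᵏd≡detW ⟨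
    conj ((2ᵍ ^ᵍ k) *ᵍ d) *ᵍ ((2ᵍ ^ᵍ k) *ᵍ d)
      ≡⟨ cong (_*ᵍ ((2ᵍ ^ᵍ k) *ᵍ d)) (trans (conj-*ᵍ (2ᵍ ^ᵍ k) d) (cong (_*ᵍ conj d) (conj-^ᵍ 2ᵍ k))) ⟩
    ((2ᵍ ^ᵍ k) *ᵍ conj d) *ᵍ ((2ᵍ ^ᵍ k) *ᵍ d)        ≡⟨ regroup (2ᵍ ^ᵍ k) (conj d) d ⟩
    ((2ᵍ ^ᵍ k) *ᵍ (2ᵍ ^ᵍ k)) *ᵍ (conj d *ᵍ d)        ≡⟨ cong (_*ᵍ (conj d *ᵍ d)) (^ᵍ-+ 2ᵍ k k) ⟨
    (2ᵍ ^ᵍ (k ℕ.+ k)) *ᵍ (conj d *ᵍ d)               ∎)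
    where
    open ≡-Reasoning
    regroup : ∀ p x y → (p *ᵍ x) *ᵍ (p *ᵍ y) ≡ (p *ᵍ p) *ᵍ (x *ᵍ y)
    regroup = solve-∀ ℤ[i]-ring

  column<n : (j : Fin k) → 2 ℕ.* toℕ j ℕ.+ t ℕ.< n
  column<n j = subst (2 ℕ.* toℕ j ℕ.+ t ℕ.<_) (sym (trans n≡t+2k (ℕ.+-comm t (k ℕ.+ k))))
                 (ℕ.+-monoˡ-< t (subst (2 ℕ.* toℕ j ℕ.<_) (cong (k ℕ.+_) (ℕ.+-identityʳ k)) (ℕ.*-monoʳ-< 2 (toℕ<n j))))

  column : Fin k → Fin n
  column j = fromℕ< (column<n j)

  toℕ-column : ∀ j → toℕ (column j) ≡ 2 ℕ.* toℕ j ℕ.+ t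
  toℕ-column j = toℕ-fromℕ< (column<n j)

  column-injective : ∀ {j j′} → column j ≡ column j′ → j ≡ j′
  column-injective {j} {j′} eq = toℕ-injective (ℕ.*-cancelˡ-≡ (toℕ j) (toℕ j′) 2
    (ℕ.+-cancelʳ-≡ t _ _ (trans (sym (toℕ-column j)) (trans (cong toℕ eq) (toℕ-column j′)))))

  W̃₁-columns : ∀ r j → ((W *) ⊗ W̃₁ A) r j ≡ H r (column j)
  W̃₁-columns r j = Σᵍ-cong (λ l → cong (λ m → conj (W l r) *ᵍ walkVec A m l) (sym (toℕ-column j)))

  t≤column : ∀ j → t ℕ.≤ toℕ (column j)
  t≤column j = subst (t ℕ.≤_) (sym (toℕ-column j)) (ℕ.m≤n+m t (2 ℕ.* toℕ j))

lemma31 : (n : ℕ) (G : MixedGraph n) → SelfConverse G →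
    let A = hermAdj G
        W = walkMatrix A
        P = (W *) ⊗ W̃₁ A
    in Σ ℤ[i] (λ d → (2ᵍ ^ᵍ (n / 2)) *ᵍ d ≡ det W × Odd d) →
       Σ (Mat n (n / 2)) (λ M → (∀ r c → 2ᵍ *ᵍ M r c ≡ P r c) × IsRank₁₊ᵢ M (n / 2))
lemma31 n G _ (d , 2ᵏd≡detW , d-odd) = M , M-spec , ((λ j → j) , independent) , HasIndepCols-≤ (λ r j → red (M r j))
  where
  open Gram (hermAdj G) (hermAdj-hermitian G) (hermAdj-loopless G)
  M : Mat n k
  M r j = half r (column j)
  M-spec : ∀ r j → 2ᵍ *ᵍ M r j ≡ ((W *) ⊗ W̃₁ (hermAdj G)) r j
  M-spec r j = trans (half-spec r (column j) (t≤column j)) (sym (W̃₁-columns r j))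
  det-half-odd : red (det half) ≡ true
  det-half-odd = trans (cong red (det-half≡norm d 2ᵏd≡detW))
                       (trans (red-*ᵍ (conj d) d) (cong₂ _∧_ (trans (red-conj d) (Odd⇒red≡true d d-odd)) (Odd⇒red≡true d d-odd)))
  independent : LinIndep (λ j r → red (M r j))
  independent = columns-independent half column column-injective det-half-odd
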